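{- For $k \ge 1$ and $n \ge k+3$, $$|\mathscr{L}(n,k)| = \sum_{i=0}^{n-k-3} (i+1)\, |\mathscr{B}(n-i,k)|.$$
   Context: All lattices are finite. Reducible element: join-reducible ($x=y\vee z$, $y,z\neq x$) or meet-reducible ($x = y \wedge z$, $y,z\neq x$). RC-lattice: finite lattice in which all reducible elements are pairwise comparable. Nullity of a finite poset: $m - n + c$ for its cover graph ($m$ covering pairs, $n$ elements, $c$ components). Block: finite lattice whose greatest element is join-reducible and least element is meet-reducible. $\mathscr{B}(n,k)$: the set of isomorphism classes of blocks on $n$ elements, of nullity $k$, whose reducible elements are pairwise comparable. $\mathscr{L}(n,k)$: the set of isomorphism classes of RC-lattices on $n$ elements having nullity $k$. -}

module Defs where

open import Data.Nat using (ℕ; zero; suc; _+_; _*_; _∸_; _≤_)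
open import Data.Fin as Fin using (Fin)
open import Data.Bool using (Bool; T)
open import Data.Product using (Σ; ∃; _×_; _,_)
open import Data.Sum using (_⊎_)
open import Data.List using (List; length)
open import Data.List.Membership.Propositional using (_∈_)
open import Data.List.Relation.Unary.Unique.Propositional using (Unique)
open import Data.Vec using (Vec; lookup)
open import Relation.Binary.PropositionalEquality using (_≡_; _≢_)
open import Relation.Binary.Construct.Closure.ReflexiveTransitive using (Star)
open import Relation.Nullary using (¬_)

Rel : ℕ → Set
Rel n = Fin n → Fin n → Bool

module _ {n : ℕ} (R : Rel n) where

  _≼_ : Fin n → Fin n → Set
  x ≼ y = T (R x y)

  IsPartialOrder : Set
  IsPartialOrder =
    (∀ x → x ≼ x) ×
    (∀ x y → x ≼ y → y ≼ x → x ≡ y) ×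
    (∀ x y z → x ≼ y → y ≼ z → x ≼ z)

  IsJoin : Fin n → Fin n → Fin n → Set
  IsJoin x y z = x ≼ z × y ≼ z × (∀ w → x ≼ w → y ≼ w → z ≼ w)

  IsMeet : Fin n → Fin n → Fin n → Set
  IsMeet x y z = z ≼ x × z ≼ y × (∀ w → w ≼ x → w ≼ y → w ≼ z)

  IsLattice : Set
  IsLattice = IsPartialOrder × (0 Data.Nat.< n) ×
    (∀ x y → ∃ λ z → IsJoin x y z) × (∀ x y → ∃ λ z → IsMeet x y z)

  JoinReducible : Fin n → Set
  JoinReducible x = ∃ λ y → ∃ λ z → y ≢ x × z ≢ x × IsJoin y z x

  MeetReducible : Fin n → Set
  MeetReducible x = ∃ λ y → ∃ λ z → y ≢ x × z ≢ x × IsMeet y z x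

  Reducible : Fin n → Set
  Reducible x = JoinReducible x ⊎ MeetReducible x

  Comparable : Fin n → Fin n → Set
  Comparable x y = x ≼ y ⊎ y ≼ x

  ReduciblesComparable : Set
  ReduciblesComparable = ∀ x y → Reducible x → Reducible y → Comparable x y

  IsGreatest : Fin n → Set
  IsGreatest t = ∀ x → x ≼ t

  IsLeast : Fin n → Set
  IsLeast b = ∀ x → b ≼ x

  IsBlockShape : Set
  IsBlockShape = (∀ t → IsGreatest t → JoinReducible t) × (∀ b → IsLeast b → MeetReducible b)

  Covers : Fin n → Fin n → Set
  Covers x y = x ≼ y × x ≢ y × (∀ z → x ≼ z → z ≼ y → z ≡ x ⊎ z ≡ y)

  CoverPair : Fin n × Fin n → Set
  CoverPair (x , y) = Covers x y

  Adjacent : Fin n → Fin n → Set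
  Adjacent x y = Covers x y ⊎ Covers y x

  Connected : Fin n → Fin n → Set
  Connected = Star Adjacent

  -- x is the Fin-least vertex of its connected component (one per component)
  ComponentRep : Fin n → Set
  ComponentRep x = ∀ y → Connected x y → x Fin.≤ y

HasCard : {A : Set} → (A → Set) → ℕ → Set
HasCard {A} P m = ∃ λ (xs : List A) → length xs ≡ m × Unique xs ×
  (∀ a → (a ∈ xs → P a) × (P a → a ∈ xs))

-- nullity of the poset (Fin n, R): m - n + c = k, written as m + c = n + k
HasNullity : {n : ℕ} → Rel n → ℕ → Set
HasNullity {n} R k = ∃ λ m → ∃ λ c →
  HasCard (CoverPair R) m × HasCard (ComponentRep R) c × m + c ≡ n + k

Iso : {n : ℕ} → Rel n → Rel n → Set
Iso {n} R S = Σ (Fin n → Fin n) λ f → Σ (Fin n → Fin n) λ g →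
  (∀ x → g (f x) ≡ x) × (∀ y → f (g y) ≡ y) × (∀ x y → R x y ≡ S (f x) (f y))

HasIsoClassCount : (n : ℕ) → (Rel n → Set) → ℕ → Set
HasIsoClassCount n P c = Σ (Vec (Rel n) c) λ reps →
  (∀ i → P (lookup reps i)) ×
  (∀ i j → Iso (lookup reps i) (lookup reps j) → i ≡ j) ×
  (∀ R → P R → ∃ λ i → Iso R (lookup reps i))

IsRCLatticeOfNullity : (k : ℕ) → {n : ℕ} → Rel n → Set
IsRCLatticeOfNullity k R = IsLattice R × ReduciblesComparable R × HasNullity R k

IsRCBlockOfNullity : (k : ℕ) → {n : ℕ} → Rel n → Set
IsRCBlockOfNullity k R = IsLattice R × IsBlockShape R × ReduciblesComparable R × HasNullity R k

{-# OPTIONS --safe #-}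

-- An RC lattice L of nullity k ≥ 1 is not a chain (a chain has nullity 0). Number its elements
-- along a linear extension and let u be the meet-reducible element of least index and v the
-- join-reducible element of greatest index. Every element of index below u (above v) is comparable
-- with everything, since the meet (join) of an incomparable pair is meet- (join-) reducible; so L is
-- the ordinal sum of a chain, the block [u, v] and another chain. The chain lengths are isomorphism
-- invariants: the lower chain consists of the elements strictly below every meet-reducible element,
-- the upper one of those strictly above every join-reducible element. Gluing chains onto a block
-- adds as many covers as elements, so the block [u, v] has nullity k too, and it has at least k + 3
-- elements because its covers inject into two tagged copies of its elements, missing four codes.
-- Summing over the block size n - i (i ≤ n - k - 3) and the lower chain length a ≤ i gives the formula.

module Submission where

open import Defs
open import Data.Bool using (Bool; true; false; T; T?)
open import Data.Bool.Properties using () renaming (_≟_ to _≟ᵇ_)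
open import Data.Empty using (⊥; ⊥-elim)
open import Data.Fin as Fin using (Fin; toℕ; fromℕ<; splitAt; _↑ˡ_; _↑ʳ_)
open import Data.Fin.Properties
  using (toℕ<n; toℕ-injective; toℕ-fromℕ<; toℕ-fromℕ; toℕ-inject₁; toℕ-inject≤; toℕ≤pred[n];
         splitAt⁻¹-↑ˡ; splitAt⁻¹-↑ʳ; cantor-schröder-bernstein; all?; any?; ¬∀⟶∃¬)
  renaming (_≟_ to _≟ᶠ_)
open import Data.List using (List; []; _∷_; length; map; _++_; filter; allFin; cartesianProduct; upTo)
open import Data.List.Membership.DecPropositional using (_∈?_)
open import Data.List.Membership.Propositional using (_∈_)
open import Data.List.Membership.Propositional.Properties
  using (∈-map⁺; ∈-map⁻; ∈-++⁺ˡ; ∈-++⁺ʳ; ∈-++⁻; ∈-filter⁺; ∈-filter⁻; ∈-allFin; ∈-cartesianProduct⁺)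
open import Data.List.Membership.Propositional.Properties.WithK using (unique∧set⇒bag)
open import Data.List.Properties using (length-map; length-++; length-tabulate; upTo-∷ʳ; map-++)
open import Data.List.Relation.Binary.BagAndSetEquality using (∼bag⇒↭)
open import Data.List.Relation.Binary.Permutation.Propositional.Properties using (↭-length)
open import Data.List.Relation.Unary.All as All using (All; []; _∷_)
open import Data.List.Relation.Unary.AllPairs using ([]; _∷_)
open import Data.List.Relation.Unary.Any using (here)
open import Data.List.Relation.Unary.Unique.Propositional using (Unique)
import Data.List.Relation.Unary.Unique.Propositional.Properties as Unique
open import Data.Maybe using (Maybe; just; nothing; maybe)
import Data.Maybe as Maybe
open import Data.Nat using (ℕ; zero; suc; pred; _+_; _*_; _∸_; _≤_; _<_; z≤n; s≤s; _<?_; _≤ᵇ_; >-nonZero)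
open import Data.Nat.ListAction using (sum)
open import Data.Nat.ListAction.Properties using (sum-++)
open import Data.Nat.Properties
open import Data.Nat.Tactic.RingSolver using (solve-∀)
open import Data.Product using (Σ; ∃; _×_; _,_; proj₁; proj₂)
open import Data.Product.Properties using (,-injective; ≡-dec)
open import Data.Sum using (_⊎_; inj₁; inj₂; [_,_])
import Data.Sum as Sum
open import Data.Unit using (tt)
open import Data.Vec using ([]; lookup; tabulate) renaming (_++_ to _++ᵛ_)
open import Data.Vec.Properties using (lookup-++ˡ; lookup-++ʳ; lookup∘tabulate)
open import Function using (_∘_; _∘′_; _$_; flip; case_of_)
open import Function.Bundles using (mk⇔)
open import Relation.Binary.Construct.Closure.ReflexiveTransitive using (ε; _◅_; _◅◅_; gmap; reverse)
open import Relation.Binary.Definitions using (DecidableEquality; tri<; tri≈; tri>)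
open import Relation.Binary.PropositionalEquality
  using (_≡_; _≢_; refl; sym; trans; cong; cong₂; subst; subst₂; module ≡-Reasoning)
open import Relation.Nullary using (¬_; Dec; yes; no; ¬?)
open import Relation.Nullary.Decidable using (_⊎-dec_; _×-dec_; _→-dec_; decidable-stable)
open import Relation.Unary using (_⊆_; _≐_; _∪_; _∩_; ∁; Empty; Decidable; U)

private variable
  A : Set
  P Q : A → Set
  c c′ k n : ℕ
  R S : Rel n
  x x′ y y′ z z′ : Fin n


-- Cardinalities of finite predicates

card-unique : HasCard P c → HasCard P c′ → c ≡ c′
card-unique (xs , refl , xs! , xs≈P) (ys , refl , ys! , ys≈P) =
  ↭-length (∼bag⇒↭ (unique∧set⇒bag xs! ys! (mk⇔ (λ x∈ → proj₂ (ys≈P _) (proj₁ (xs≈P _) x∈))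
                                                 (λ y∈ → proj₂ (xs≈P _) (proj₁ (ys≈P _) y∈)))))

card-cong : P ≐ Q → HasCard P c → HasCard Q c
card-cong (P⊆Q , Q⊆P) (xs , len , xs! , xs≈P) =
  xs , len , xs! , λ a → (λ a∈ → P⊆Q (proj₁ (xs≈P a) a∈)) , (λ qa → proj₂ (xs≈P a) (Q⊆P qa))

card-∪ : Empty (P ∩ Q) → HasCard P c → HasCard Q c′ → HasCard (P ∪ Q) (c + c′)
card-∪ disjoint (xs , refl , xs! , xs≈P) (ys , refl , ys! , ys≈Q) =
  xs ++ ys , length-++ xs ,
  Unique.++⁺ xs! ys! (λ (v∈xs , v∈ys) → disjoint _ (proj₁ (xs≈P _) v∈xs , proj₁ (ys≈Q _) v∈ys)) ,
  λ a → (λ a∈ → Sum.map (proj₁ (xs≈P a)) (proj₁ (ys≈Q a)) (∈-++⁻ xs a∈)) ,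
        [ (λ pa → ∈-++⁺ˡ (proj₂ (xs≈P a) pa)) , (λ qa → ∈-++⁺ʳ xs (proj₂ (ys≈Q a) qa)) ]

Image : ∀ {B : Set} → (A → B) → (A → Set) → B → Set
Image f P b = ∃ λ a → P a × f a ≡ b

InjectiveOn : ∀ {B : Set} → (A → B) → (A → Set) → Set
InjectiveOn f P = ∀ {x y} → P x → P y → f x ≡ f y → x ≡ y

private
  map-unique : ∀ {B : Set} {f : A → B} {xs : List A} → InjectiveOn f P → All P xs → Unique xs → Unique (map f xs)
  map-unique f-inj [] [] = []
  map-unique {P = P} {f = f} f-inj (px ∷ pxs) (x∉xs ∷ xs!) =
    distinct px pxs x∉xs ∷ map-unique f-inj pxs xs!
    where
    distinct : ∀ {x ys} → P x → All P ys → All (x ≢_) ys → All (f x ≢_) (map f ys)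
    distinct px [] [] = []
    distinct px (py ∷ pys) (x≢y ∷ x≢ys) = (λ fx≡fy → x≢y (f-inj px py fx≡fy)) ∷ distinct px pys x≢ys

card-image : ∀ {B : Set} (f : A → B) → InjectiveOn f P → HasCard P c → HasCard (Image f P) c
card-image f f-inj (xs , refl , xs! , xs≈P) =
  map f xs , length-map f xs ,
  map-unique f-inj (All.tabulate (λ a∈ → proj₁ (xs≈P _) a∈)) xs! ,
  λ b → (λ b∈ → let (a , a∈ , b≡fa) = ∈-map⁻ f b∈ in a , proj₁ (xs≈P a) a∈ , sym b≡fa) ,
        (λ { (a , pa , refl) → ∈-map⁺ f (proj₂ (xs≈P a) pa) })

card-∩ : HasCard P c → Decidable Q → ∃ λ c′ → HasCard (P ∩ Q) c′
card-∩ (xs , _ , xs! , xs≈P) Q? =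
  _ , filter Q? xs , refl , Unique.filter⁺ Q? xs! ,
  λ a → (λ a∈ → let (a∈xs , qa) = ∈-filter⁻ Q? a∈ in proj₁ (xs≈P a) a∈xs , qa) ,
        (λ (pa , qa) → ∈-filter⁺ Q? (proj₂ (xs≈P a) pa) qa)

card-list : {xs : List A} → Unique xs → HasCard (_∈ xs) (length xs)
card-list {xs = xs} xs! = xs , refl , xs! , λ _ → (λ a∈ → a∈) , (λ a∈ → a∈)

-- Comparing counts needs decidable equality: the complement of P in Q must be countable.
module _ {A : Set} (_≟_ : DecidableEquality A) {P Q : A → Set} where

  card-split : P ⊆ Q → HasCard P c → HasCard Q c′ → ∃ λ e → HasCard (Q ∩ ∁ P) e × c′ ≡ c + e
  card-split P⊆Q hP@(xs , _ , _ , xs≈P) hQ =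
    let (e , hR) = card-∩ hQ (¬? ∘ P?) in
    e , hR , card-unique hQ (card-cong ([ P⊆Q , proj₁ ] , Q⊆P∪R) (card-∪ (λ a (pa , _ , ¬pa) → ¬pa pa) hP hR))
    where
    P? : Decidable P
    P? a with _∈?_ _≟_ a xs
    ... | yes a∈ = yes (proj₁ (xs≈P a) a∈)
    ... | no a∉ = no (λ pa → a∉ (proj₂ (xs≈P a) pa))
    Q⊆P∪R : Q ⊆ P ∪ (Q ∩ ∁ P)
    Q⊆P∪R {a} qa with P? a
    ... | yes pa = inj₁ pa
    ... | no ¬pa = inj₂ (qa , ¬pa)

  card-∖ : P ⊆ Q → HasCard P c → HasCard Q c′ → HasCard (Q ∩ ∁ P) (c′ ∸ c)
  card-∖ {c = c} P⊆Q hP hQ with card-split P⊆Q hP hQ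
  ... | e , hR , refl = subst (HasCard _) (sym (m+n∸m≡n c e)) hR

  card-mono : P ⊆ Q → HasCard P c → HasCard Q c′ → c ≤ c′
  card-mono P⊆Q hP hQ with card-split P⊆Q hP hQ
  ... | e , _ , refl = m≤m+n _ e

  card-mono-< : ∀ {a} → P ⊆ Q → Q a → ¬ P a → HasCard P c → HasCard Q c′ → c < c′
  card-mono-< {a = a} P⊆Q qa ¬pa hP hQ with card-split P⊆Q hP hQ
  ... | zero , ([] , _ , _ , []≈R) , _ = case proj₂ ([]≈R a) (qa , ¬pa) of λ ()
  ... | suc e , _ , refl = m<m+n _ (s≤s z≤n)

card-decidable : ∀ {P : A → Set} → HasCard (U {A = A}) c → Decidable P → ∃ (HasCard P)
card-decidable hU P? = let (c′ , hU∩P) = card-∩ hU P? in c′ , card-cong (proj₂ , (λ pa → _ , pa)) hU∩P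

card-Fin : HasCard (U {A = Fin n}) n
card-Fin {n = n} = allFin n , length-tabulate (λ i → i) , Unique.allFin⁺ n , λ a → (λ _ → _) , (λ _ → ∈-allFin a)

card-Fin< : ∀ {n a} → a ≤ n → HasCard (λ (x : Fin n) → toℕ x < a) a
card-Fin< {n} {a} a≤n = card-cong (image⊆ , ⊆image) (card-image (λ i → Fin.inject≤ i a≤n) inject-injective card-Fin)
  where
  inject-injective : InjectiveOn (λ i → Fin.inject≤ i a≤n) U
  inject-injective {i} {j} _ _ eq =
    toℕ-injective (trans (sym (toℕ-inject≤ i a≤n)) (trans (cong toℕ eq) (toℕ-inject≤ j a≤n)))
  image⊆ : Image (λ i → Fin.inject≤ i a≤n) U ⊆ (λ x → toℕ x < a)
  image⊆ (i , _ , refl) = subst (_< a) (sym (toℕ-inject≤ i a≤n)) (toℕ<n i)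
  ⊆image : (λ (x : Fin n) → toℕ x < a) ⊆ Image (λ i → Fin.inject≤ i a≤n) U
  ⊆image {x} x<a = fromℕ< x<a , _ , toℕ-injective (trans (toℕ-inject≤ _ a≤n) (toℕ-fromℕ< x<a))

card-injection-avoiding : ∀ {B : Set} {es : List B} → DecidableEquality B → (f : A → B) → InjectiveOn f P →
                          Unique es → All (λ e → ∀ {a} → P a → f a ≢ e) es →
                          HasCard P c → HasCard (U {A = B}) c′ → c + length es ≤ c′
card-injection-avoiding _≟_ f f-injective es! avoided hP hU =
  card-mono _≟_ (λ _ → _)
    (card-∪ (λ { _ ((a , pa , refl) , b∈es) → All.lookup avoided b∈es pa refl })
            (card-image f f-injective hP) (card-list es!))
    hU

card-×Bool : HasCard (U {A = A}) c → HasCard (U {A = A × Bool}) (c + c)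
card-×Bool hU =
  card-cong ((λ _ → _) , λ { {a , true} _ → inj₁ (a , _ , refl) ; {a , false} _ → inj₂ (a , _ , refl) })
    (card-∪ (λ { _ ((_ , _ , refl) , (_ , _ , ())) })
      (card-image (_, true) (λ _ _ → cong proj₁) hU) (card-image (_, false) (λ _ _ → cong proj₁) hU))


-- Isomorphisms and isomorphism classes

-- Iso is a Σ-type in which the relations occur only under the bijection, so Agda cannot
-- infer them from an Iso; this wrapper is a record and hence injective in R and S.
record _≅_ {n : ℕ} (R S : Rel n) : Set where
  constructor mk≅
  field
    iso : Iso R S

  to : Fin n → Fin n
  to = proj₁ iso

  from : Fin n → Fin n
  from = proj₁ (proj₂ iso)

  from∘to : ∀ x → from (to x) ≡ x
  from∘to = proj₁ (proj₂ (proj₂ iso))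

  to∘from : ∀ y → to (from y) ≡ y
  to∘from = proj₁ (proj₂ (proj₂ (proj₂ iso)))

  homo : ∀ x y → R x y ≡ S (to x) (to y)
  homo = proj₂ (proj₂ (proj₂ (proj₂ iso)))

open _≅_ using (iso)

≅-refl : R ≅ R
≅-refl = mk≅ ((λ x → x) , (λ x → x) , (λ _ → refl) , (λ _ → refl) , (λ _ _ → refl))

≅-sym : R ≅ S → S ≅ R
≅-sym {R = R} {S = S} R≅S = mk≅ (from , to , to∘from , from∘to ,
  λ x y → sym (trans (homo (from x) (from y)) (cong₂ S (to∘from x) (to∘from y))))
  where open _≅_ R≅S

≅-trans : ∀ {R₁ R₂ R₃ : Rel n} → R₁ ≅ R₂ → R₂ ≅ R₃ → R₁ ≅ R₃
≅-trans F G = mk≅ ((λ x → G.to (F.to x)) , (λ z → F.from (G.from z)) ,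
  (λ x → trans (cong F.from (G.from∘to (F.to x))) (F.from∘to x)) ,
  (λ z → trans (cong G.to (F.to∘from (G.from z))) (G.to∘from z)) ,
  λ x y → trans (F.homo x y) (G.homo (F.to x) (F.to y)))
  where module F = _≅_ F
        module G = _≅_ G

≗⇒≅ : (∀ x y → R x y ≡ S x y) → R ≅ S
≗⇒≅ R≗S = mk≅ ((λ x → x) , (λ x → x) , (λ _ → refl) , (λ _ → refl) , R≗S)

private
  class : HasIsoClassCount n P c → HasIsoClassCount n P c′ → Fin c → Fin c′
  class (xs , xs-P , _) (_ , _ , _ , ys-classify) i = proj₁ (ys-classify (lookup xs i) (xs-P i))

  class-injective : (X : HasIsoClassCount n P c) (Y : HasIsoClassCount n P c′) →
                    ∀ {i j} → class X Y i ≡ class X Y j → i ≡ j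
  class-injective (xs , xs-P , xs-distinct , _) (ys , _ , _ , ys-classify) {i} {j} same =
    xs-distinct i j (iso (≅-trans (rep≅ i) (≅-sym (subst (λ k → lookup xs j ≅ lookup ys k) (sym same) (rep≅ j)))))
    where
    rep≅ : ∀ i → lookup xs i ≅ lookup ys (proj₁ (ys-classify (lookup xs i) (xs-P i)))
    rep≅ i = mk≅ (proj₂ (ys-classify (lookup xs i) (xs-P i)))

hic-unique : HasIsoClassCount n P c → HasIsoClassCount n P c′ → c ≡ c′
hic-unique X Y = cantor-schröder-bernstein (class-injective X Y) (class-injective Y X)

hic-cong : P ≐ Q → HasIsoClassCount n P c → HasIsoClassCount n Q c
hic-cong (P⊆Q , Q⊆P) (xs , xs-P , xs-distinct , xs-cover) =
  xs , (λ i → P⊆Q (xs-P i)) , xs-distinct , λ R qR → xs-cover R (Q⊆P qR)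

hic-∅ : Empty P → HasIsoClassCount n P 0
hic-∅ P-empty = [] , (λ ()) , (λ ()) , λ R pR → ⊥-elim (P-empty R pR)

private
  data SplitView (c : ℕ) {c′ : ℕ} : Fin (c + c′) → Set where
    left  : ∀ i → SplitView c (i ↑ˡ c′)
    right : ∀ j → SplitView c (c ↑ʳ j)

  splitView : ∀ c {c′} (i : Fin (c + c′)) → SplitView c i
  splitView c i with splitAt c i in eq
  ... | inj₁ j = subst (SplitView c) (splitAt⁻¹-↑ˡ eq) (left j)
  ... | inj₂ j = subst (SplitView c) (splitAt⁻¹-↑ʳ eq) (right j)

hic-∪ : (∀ {R S} → P R → Q S → ¬ R ≅ S) →
        HasIsoClassCount n P c → HasIsoClassCount n Q c′ → HasIsoClassCount n (P ∪ Q) (c + c′)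
hic-∪ {P = P} {Q = Q} {c = c} {c′ = c′} P≇Q
      (xs , xs-P , xs-distinct , xs-cover) (ys , ys-P , ys-distinct , ys-cover) =
  xs ++ᵛ ys , in-P∪Q , distinct , cover
  where
  in-P∪Q : ∀ i → (P ∪ Q) (lookup (xs ++ᵛ ys) i)
  in-P∪Q i with splitView c i
  ... | left i  = inj₁ (subst P (sym (lookup-++ˡ xs ys i)) (xs-P i))
  ... | right j = inj₂ (subst Q (sym (lookup-++ʳ xs ys j)) (ys-P j))
  distinct : ∀ i j → Iso (lookup (xs ++ᵛ ys) i) (lookup (xs ++ᵛ ys) j) → i ≡ j
  distinct i j i≅j with splitView c i | splitView c j
  ... | left i  | left j  = cong (_↑ˡ c′) (xs-distinct i j (subst₂ Iso (lookup-++ˡ xs ys i) (lookup-++ˡ xs ys j) i≅j))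
  ... | left i  | right j =
    ⊥-elim (P≇Q (xs-P i) (ys-P j) (mk≅ (subst₂ Iso (lookup-++ˡ xs ys i) (lookup-++ʳ xs ys j) i≅j)))
  ... | right i | left j  =
    ⊥-elim (P≇Q (xs-P j) (ys-P i) (≅-sym (mk≅ (subst₂ Iso (lookup-++ʳ xs ys i) (lookup-++ˡ xs ys j) i≅j))))
  ... | right i | right j = cong (c ↑ʳ_) (ys-distinct i j (subst₂ Iso (lookup-++ʳ xs ys i) (lookup-++ʳ xs ys j) i≅j))
  cover : ∀ R → (P ∪ Q) R → ∃ λ i → Iso R (lookup (xs ++ᵛ ys) i)
  cover R (inj₁ pR) = let (i , R≅) = xs-cover R pR in i ↑ˡ c′ , subst (Iso R) (sym (lookup-++ˡ xs ys i)) R≅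
  cover R (inj₂ qR) = let (j , R≅) = ys-cover R qR in c ↑ʳ j , subst (Iso R) (sym (lookup-++ʳ xs ys j)) R≅

sum-upTo-suc : ∀ (f : ℕ → ℕ) t → sum (map f (upTo (suc t))) ≡ sum (map f (upTo t)) + f t
sum-upTo-suc f t = begin
  sum (map f (upTo (suc t)))            ≡⟨ cong (sum ∘′ map f) (sym (upTo-∷ʳ t)) ⟩
  sum (map f (upTo t ++ t ∷ []))        ≡⟨ cong sum (map-++ f (upTo t) (t ∷ [])) ⟩
  sum (map f (upTo t) ++ f t ∷ [])      ≡⟨ sum-++ (map f (upTo t)) (f t ∷ []) ⟩
  sum (map f (upTo t)) + (f t + 0)      ≡⟨ cong (sum (map f (upTo t)) +_) (+-identityʳ (f t)) ⟩
  sum (map f (upTo t)) + f t            ∎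
  where open ≡-Reasoning

hic-⋃ : (P : ℕ → Rel n → Set) (count : ℕ → ℕ) (t : ℕ) →
        (∀ {i j R S} → i < t → j < t → P i R → P j S → R ≅ S → i ≡ j) →
        (∀ i → i < t → HasIsoClassCount n (P i) (count i)) →
        HasIsoClassCount n (λ R → ∃ λ i → i < t × P i R) (sum (map count (upTo t)))
hic-⋃ P count zero _ _ = hic-∅ (λ R → λ { (_ , () , _) })
hic-⋃ P count (suc t) P-disjoint P-count =
  subst (HasIsoClassCount _ _) (sym (sum-upTo-suc count t))
    (hic-cong (from-∪ , to-∪)
      (hic-∪ (λ (i , i<t , pR) pS R≅S → <-irrefl (P-disjoint (m<n⇒m<1+n i<t) ≤-refl pR pS R≅S) i<t)
        (hic-⋃ P count t (λ i<t j<t → P-disjoint (m<n⇒m<1+n i<t) (m<n⇒m<1+n j<t))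
                         (λ i i<t → P-count i (m<n⇒m<1+n i<t)))
        (P-count t ≤-refl)))
  where
  from-∪ : ∀ {R} → (∃ λ i → i < t × P i R) ⊎ P t R → ∃ λ i → i < suc t × P i R
  from-∪ (inj₁ (i , i<t , pR)) = i , m<n⇒m<1+n i<t , pR
  from-∪ (inj₂ pR) = t , ≤-refl , pR
  to-∪ : ∀ {R} → (∃ λ i → i < suc t × P i R) → (∃ λ i → i < t × P i R) ⊎ P t R
  to-∪ (i , s≤s i≤t , pR) with m≤n⇒m<n∨m≡n i≤t
  ... | inj₁ i<t = inj₁ (i , i<t , pR)
  ... | inj₂ refl = inj₂ pR

sum-upTo-const : ∀ c t → sum (map (λ _ → c) (upTo t)) ≡ t * c
sum-upTo-const c zero = refl
sum-upTo-const c (suc t) =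
  trans (sum-upTo-suc (λ _ → c) t) (trans (cong (_+ c) (sum-upTo-const c t)) (+-comm (t * c) c))


-- Joins, meets and reducibility

module _ {R : Rel n} (po : IsPartialOrder R) where
  private
    refl≼ = proj₁ po
    antisym≼ = proj₁ (proj₂ po)

  join-unique : IsJoin R x y z → IsJoin R x y z′ → z ≡ z′
  join-unique (x≼z , y≼z , z-least) (x≼z′ , y≼z′ , z′-least) =
    antisym≼ _ _ (z-least _ x≼z′ y≼z′) (z′-least _ x≼z y≼z)

  meet-unique : IsMeet R x y z → IsMeet R x y z′ → z ≡ z′
  meet-unique (z≼x , z≼y , z-greatest) (z′≼x , z′≼y , z′-greatest) =
    antisym≼ _ _ (z′-greatest _ z≼x z≼y) (z-greatest _ z′≼x z′≼y)

  ≼⇒isJoin : T (R x y) → IsJoin R x y y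
  ≼⇒isJoin x≼y = x≼y , refl≼ _ , λ _ _ y≼w → y≼w

  ≼⇒isMeet : T (R x y) → IsMeet R x y x
  ≼⇒isMeet x≼y = refl≼ _ , x≼y , λ _ w≼x _ → w≼x

  comparable⇒join : Comparable R x y → ∃ (IsJoin R x y)
  comparable⇒join (inj₁ x≼y) = _ , ≼⇒isJoin x≼y
  comparable⇒join (inj₂ y≼x) = _ , (refl≼ _ , y≼x , λ _ x≼w _ → x≼w)

  comparable⇒meet : Comparable R x y → ∃ (IsMeet R x y)
  comparable⇒meet (inj₁ x≼y) = _ , ≼⇒isMeet x≼y
  comparable⇒meet (inj₂ y≼x) = _ , (y≼x , refl≼ _ , λ _ _ w≼y → w≼y)

  comparable⇒join-trivial : Comparable R x y → IsJoin R x y z → z ≡ x ⊎ z ≡ y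
  comparable⇒join-trivial (inj₁ x≼y) J = inj₂ (join-unique J (≼⇒isJoin x≼y))
  comparable⇒join-trivial (inj₂ y≼x) J = inj₁ (join-unique J (refl≼ _ , y≼x , λ _ x≼w _ → x≼w))

  comparable⇒meet-trivial : Comparable R x y → IsMeet R x y z → z ≡ x ⊎ z ≡ y
  comparable⇒meet-trivial (inj₁ x≼y) M = inj₁ (meet-unique M (≼⇒isMeet x≼y))
  comparable⇒meet-trivial (inj₂ y≼x) M = inj₂ (meet-unique M (y≼x , refl≼ _ , λ _ _ w≼y → w≼y))

  incomparable⇒joinReducible : ¬ Comparable R x y → IsJoin R x y z → JoinReducible R z
  incomparable⇒joinReducible x∥y J@(x≼z , y≼z , _) =
    _ , _ , (λ { refl → x∥y (inj₂ y≼z) }) , (λ { refl → x∥y (inj₁ x≼z) }) , J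

  incomparable⇒meetReducible : ¬ Comparable R x y → IsMeet R x y z → MeetReducible R z
  incomparable⇒meetReducible x∥y M@(z≼x , z≼y , _) =
    _ , _ , (λ { refl → x∥y (inj₁ z≼y) }) , (λ { refl → x∥y (inj₂ z≼x) }) , M

module _ (R : Rel n) where

  isJoin? : ∀ x y z → Dec (IsJoin R x y z)
  isJoin? x y z = T? (R x z) ×-dec T? (R y z) ×-dec all? λ w → T? (R x w) →-dec T? (R y w) →-dec T? (R z w)

  isMeet? : ∀ x y z → Dec (IsMeet R x y z)
  isMeet? x y z = T? (R z x) ×-dec T? (R z y) ×-dec all? λ w → T? (R w x) →-dec T? (R w y) →-dec T? (R w z)

  joinReducible? : Decidable (JoinReducible R)
  joinReducible? x = any? λ y → any? λ z → ¬? (y ≟ᶠ x) ×-dec ¬? (z ≟ᶠ x) ×-dec isJoin? y z x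

  meetReducible? : Decidable (MeetReducible R)
  meetReducible? x = any? λ y → any? λ z → ¬? (y ≟ᶠ x) ×-dec ¬? (z ≟ᶠ x) ×-dec isMeet? y z x

  reducible? : Decidable (Reducible R)
  reducible? x = joinReducible? x ⊎-dec meetReducible? x

  comparable? : ∀ x y → Dec (Comparable R x y)
  comparable? x y = T? (R x y) ⊎-dec T? (R y x)

  covers? : ∀ x y → Dec (Covers R x y)
  covers? x y = T? (R x y) ×-dec ¬? (x ≟ᶠ y) ×-dec
                all? λ z → T? (R x z) →-dec T? (R z y) →-dec (z ≟ᶠ x ⊎-dec z ≟ᶠ y)

  ¬covers⇒between : T (R x y) → x ≢ y → ¬ Covers R x y →
                    ∃ λ z → T (R x z) × T (R z y) × z ≢ x × z ≢ y
  ¬covers⇒between {x} {y} x≼y x≢y ¬x⋖y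
    with ¬∀⟶∃¬ _ _ (λ z → T? (R x z) →-dec T? (R z y) →-dec (z ≟ᶠ x ⊎-dec z ≟ᶠ y)) (λ all → ¬x⋖y (x≼y , x≢y , all))
  ... | z , not-trivial with T? (R x z) | T? (R z y) | z ≟ᶠ x | z ≟ᶠ y
  ...   | yes x≼z | yes z≼y | no z≢x | no z≢y = z , x≼z , z≼y , z≢x , z≢y
  ...   | no x⋠z | _ | _ | _ = ⊥-elim (not-trivial (⊥-elim ∘ x⋠z))
  ...   | yes _ | no z⋠y | _ | _ = ⊥-elim (not-trivial (λ _ → ⊥-elim ∘ z⋠y))
  ...   | yes _ | yes _ | yes z≡x | _ = ⊥-elim (not-trivial (λ _ _ → inj₁ z≡x))
  ...   | yes _ | yes _ | no _ | yes z≡y = ⊥-elim (not-trivial (λ _ _ → inj₂ z≡y))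


-- Invariance under isomorphism

module ElementTransport {R S : Rel n} (R≅S : R ≅ S) where
  open _≅_ R≅S public using (to; from; from∘to; to∘from; homo)

  to-injective : to x ≡ to y → x ≡ y
  to-injective {x = x} {y = y} eq = trans (sym (from∘to x)) (trans (cong from eq) (from∘to y))

  ≼-to : T (R x y) → T (S (to x) (to y))
  ≼-to {x = x} {y = y} = subst T (homo x y)

  ≼-fromʳ : T (S (to x) y) → T (R x (from y))
  ≼-fromʳ {x = x} {y = y} x≼y = subst T (sym (homo x (from y))) (subst (T ∘ S (to x)) (sym (to∘from y)) x≼y)

  ≼-fromˡ : T (S x (to y)) → T (R (from x) y)
  ≼-fromˡ {x = x} {y = y} x≼y = subst T (sym (homo (from x) y)) (subst (λ u → T (S u (to y))) (sym (to∘from x)) x≼y)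

  isJoin-to : IsJoin R x y z → IsJoin S (to x) (to y) (to z)
  isJoin-to (x≼z , y≼z , z-least) = ≼-to x≼z , ≼-to y≼z ,
    λ w x≼w y≼w → subst (T ∘ S _) (to∘from w) (≼-to (z-least (from w) (≼-fromʳ x≼w) (≼-fromʳ y≼w)))

  isMeet-to : IsMeet R x y z → IsMeet S (to x) (to y) (to z)
  isMeet-to (z≼x , z≼y , z-greatest) = ≼-to z≼x , ≼-to z≼y ,
    λ w w≼x w≼y → subst (λ u → T (S u _)) (to∘from w) (≼-to (z-greatest (from w) (≼-fromˡ w≼x) (≼-fromˡ w≼y)))

  joinReducible-to : JoinReducible R x → JoinReducible S (to x)
  joinReducible-to (y , z , y≢x , z≢x , J) = to y , to z , y≢x ∘ to-injective , z≢x ∘ to-injective , isJoin-to J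

  meetReducible-to : MeetReducible R x → MeetReducible S (to x)
  meetReducible-to (y , z , y≢x , z≢x , M) = to y , to z , y≢x ∘ to-injective , z≢x ∘ to-injective , isMeet-to M

  reducible-to : Reducible R x → Reducible S (to x)
  reducible-to = Sum.map joinReducible-to meetReducible-to

  comparable-to : Comparable R x y → Comparable S (to x) (to y)
  comparable-to = Sum.map ≼-to ≼-to

  covers-to : Covers R x y → Covers S (to x) (to y)
  covers-to (x≼y , x≢y , nothing-between) = ≼-to x≼y , x≢y ∘ to-injective ,
    λ z x≼z z≼y → Sum.map (λ eq → trans (sym (to∘from z)) (cong to eq)) (λ eq → trans (sym (to∘from z)) (cong to eq))
                    (nothing-between (from z) (≼-fromʳ x≼z) (≼-fromˡ z≼y))

  onto : ∀ {P : Fin n → Set} → (∀ x → P (to x)) → ∀ y → P y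
  onto {P = P} P∘to y = subst P (to∘from y) (P∘to (from y))

module _ {n : ℕ} {R S : Rel n} (R≅S : R ≅ S) where
  private
    module ⇒ = ElementTransport R≅S
    module ⇐ = ElementTransport (≅-sym R≅S)

  isPartialOrder-≅ : IsPartialOrder R → IsPartialOrder S
  isPartialOrder-≅ (refl≼ , antisym≼ , trans≼) =
    ⇒.onto (λ x → ⇒.≼-to (refl≼ x)) ,
    (λ x y x≼y y≼x →
       trans (sym (⇒.to∘from x)) (trans (cong ⇒.to (antisym≼ _ _ (⇐.≼-to x≼y) (⇐.≼-to y≼x))) (⇒.to∘from y))) ,
    λ x y z x≼y y≼z → subst₂ (λ u v → T (S u v)) (⇒.to∘from x) (⇒.to∘from z)
                        (⇒.≼-to (trans≼ _ _ _ (⇐.≼-to x≼y) (⇐.≼-to y≼z)))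

  isLattice-≅ : IsLattice R → IsLattice S
  isLattice-≅ (po , nonempty , joins , meets) = isPartialOrder-≅ po , nonempty ,
    ⇒.onto (λ x → ⇒.onto (λ y → let (z , J) = joins x y in ⇒.to z , ⇒.isJoin-to J)) ,
    ⇒.onto (λ x → ⇒.onto (λ y → let (z , M) = meets x y in ⇒.to z , ⇒.isMeet-to M))

  reduciblesComparable-≅ : ReduciblesComparable R → ReduciblesComparable S
  reduciblesComparable-≅ rc = ⇒.onto (λ x → ⇒.onto (λ y rx ry →
    ⇒.comparable-to (rc x y (subst (Reducible R) (⇒.from∘to x) (⇐.reducible-to rx))
                            (subst (Reducible R) (⇒.from∘to y) (⇐.reducible-to ry)))))

  isBlockShape-≅ : IsBlockShape R → IsBlockShape S
  isBlockShape-≅ (top-reducible , bottom-reducible) =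
    ⇒.onto (λ t t-greatest → ⇒.joinReducible-to (top-reducible t (λ x → ≼-back (t-greatest (⇒.to x))))) ,
    ⇒.onto (λ b b-least → ⇒.meetReducible-to (bottom-reducible b (λ x → ≼-back (b-least (⇒.to x)))))
    where
    ≼-back : ∀ {x y} → T (S (⇒.to x) (⇒.to y)) → T (R x y)
    ≼-back {x} {y} = subst₂ (λ u v → T (R u v)) (⇒.from∘to x) (⇒.from∘to y) ∘ ⇐.≼-to

  coverCount-≅ : HasCard (CoverPair R) c → HasCard (CoverPair S) c
  coverCount-≅ = card-cong (image⊆covers , covers⊆image) ∘ card-image to² to²-injective
    where
    to² : Fin n × Fin n → Fin n × Fin n
    to² (x , y) = ⇒.to x , ⇒.to y
    to²-injective : InjectiveOn to² (CoverPair R)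
    to²-injective _ _ eq = let (x≡ , y≡) = ,-injective eq in cong₂ _,_ (⇒.to-injective x≡) (⇒.to-injective y≡)
    image⊆covers : Image to² (CoverPair R) ⊆ CoverPair S
    image⊆covers ((x , y) , x⋖y , refl) = ⇒.covers-to x⋖y
    covers⊆image : CoverPair S ⊆ Image to² (CoverPair R)
    covers⊆image {x , y} x⋖y = (⇐.to x , ⇐.to y) , ⇐.covers-to x⋖y , cong₂ _,_ (⇒.to∘from x) (⇒.to∘from y)


-- Natural labellings

NaturallyLabelled : Rel n → Set
NaturallyLabelled R = ∀ x y → T (R x y) → toℕ x ≤ toℕ y

injective⇒surjective : (f : Fin n → Fin n) → (∀ {x y} → f x ≡ f y → x ≡ y) → ∀ y → ∃ λ x → f x ≡ y
injective⇒surjective f f-injective y with any? (λ x → f x ≟ᶠ y)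
... | yes found = found
... | no missed = ⊥-elim (<-irrefl refl
      (card-mono-< _≟ᶠ_ (λ _ → tt) tt (λ (x , _ , fx≡y) → missed (x , fx≡y))
         (card-image f (λ _ _ → f-injective) card-Fin) card-Fin))

module _ {n : ℕ} (R : Rel n) (po : IsPartialOrder R) where
  private
    antisym≼ = proj₁ (proj₂ po)
    trans≼ = proj₂ (proj₂ po)

  -- opaque, so that the type checker never unfolds the counting
  private opaque
    count : ∀ {P : Fin n → Set} → Decidable P → ℕ
    count P? = proj₁ (card-decidable card-Fin P?)

    count-card : ∀ {P : Fin n → Set} (P? : Decidable P) → HasCard P (count P?)
    count-card P? = proj₂ (card-decidable card-Fin P?)

  private
    count-mono-< : ∀ {P Q : Fin n → Set} (P? : Decidable P) (Q? : Decidable Q) {x} →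
                   P ⊆ Q → Q x → ¬ P x → count P? < count Q?
    count-mono-< P? Q? P⊆Q qx ¬px = card-mono-< _≟ᶠ_ P⊆Q qx ¬px (count-card P?) (count-card Q?)

    height : Fin n → ℕ
    height x = count (λ z → T? (R z x))

    height-mono-< : ∀ {x y} → T (R x y) → x ≢ y → height x < height y
    height-mono-< {x} {y} x≼y x≢y =
      count-mono-< _ _ (λ {z} z≼x → trans≼ z x y z≼x x≼y) (proj₁ po y) (λ y≼x → x≢y (antisym≼ x y x≼y y≼x))

    -- a strict total order extending R: by height, ties broken by index
    _◁_ : Fin n → Fin n → Set
    z ◁ x = height z < height x ⊎ (height z ≡ height x × toℕ z < toℕ x)

    _◁?_ : ∀ z x → Dec (z ◁ x)
    z ◁? x = (height z <? height x) ⊎-dec ((height z ≟ height x) ×-dec (toℕ z <? toℕ x))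

    ◁-trans : ∀ {x y z} → x ◁ y → y ◁ z → x ◁ z
    ◁-trans (inj₁ x<y) (inj₁ y<z) = inj₁ (<-trans x<y y<z)
    ◁-trans (inj₁ x<y) (inj₂ (y≡z , _)) = inj₁ (subst (_ <_) y≡z x<y)
    ◁-trans (inj₂ (x≡y , _)) (inj₁ y<z) = inj₁ (subst (_< _) (sym x≡y) y<z)
    ◁-trans (inj₂ (x≡y , x<y)) (inj₂ (y≡z , y<z)) = inj₂ (trans x≡y y≡z , <-trans x<y y<z)

    ◁-irrefl : ∀ {x} → ¬ x ◁ x
    ◁-irrefl (inj₁ x<x) = <-irrefl refl x<x
    ◁-irrefl (inj₂ (_ , x<x)) = <-irrefl refl x<x

    ◁-connex : ∀ {x y} → x ≢ y → x ◁ y ⊎ y ◁ x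
    ◁-connex {x} {y} x≢y with <-cmp (height x) (height y) | <-cmp (toℕ x) (toℕ y)
    ... | tri< h< _ _ | _ = inj₁ (inj₁ h<)
    ... | tri> _ _ h> | _ = inj₂ (inj₁ h>)
    ... | tri≈ _ h≡ _ | tri< i< _ _ = inj₁ (inj₂ (h≡ , i<))
    ... | tri≈ _ h≡ _ | tri≈ _ i≡ _ = ⊥-elim (x≢y (toℕ-injective i≡))
    ... | tri≈ _ h≡ _ | tri> _ _ i> = inj₂ (inj₂ (sym h≡ , i>))

    rank : Fin n → ℕ
    rank x = count (_◁? x)

    rank-mono-< : ∀ {x y} → x ◁ y → rank x < rank y
    rank-mono-< {x} x◁y = count-mono-< _ _ (λ z◁x → ◁-trans z◁x x◁y) x◁y ◁-irrefl

    rank<n : ∀ x → rank x < n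
    rank<n x = subst (rank x <_) (card-unique (count-card (λ _ → yes tt)) card-Fin)
                 (count-mono-< _ (λ _ → yes tt) (λ _ → tt) tt (◁-irrefl {x}))

    label : Fin n → Fin n
    label x = fromℕ< (rank<n x)

    rank-injective : ∀ {x y} → rank x ≡ rank y → x ≡ y
    rank-injective {x} {y} same-rank with x ≟ᶠ y
    ... | yes x≡y = x≡y
    ... | no x≢y = ⊥-elim ([ (λ x◁y → <-irrefl same-rank (rank-mono-< x◁y)) ,
                            (λ y◁x → <-irrefl (sym same-rank) (rank-mono-< y◁x)) ] (◁-connex x≢y))

    label-injective : ∀ {x y} → label x ≡ label y → x ≡ y
    label-injective {x} {y} eq =
      rank-injective (trans (sym (toℕ-fromℕ< (rank<n x))) (trans (cong toℕ eq) (toℕ-fromℕ< (rank<n y))))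

    rank-mono : ∀ {x y} → T (R x y) → rank x ≤ rank y
    rank-mono {x} {y} x≼y with x ≟ᶠ y
    ... | yes refl = ≤-refl
    ... | no x≢y = <⇒≤ (rank-mono-< (inj₁ (height-mono-< x≼y x≢y)))

    label-mono : ∀ x y → T (R x y) → toℕ (label x) ≤ toℕ (label y)
    label-mono x y x≼y = subst₂ _≤_ (sym (toℕ-fromℕ< (rank<n x))) (sym (toℕ-fromℕ< (rank<n y))) (rank-mono x≼y)

    unlabel : Fin n → Fin n
    unlabel y = proj₁ (injective⇒surjective label label-injective y)

    label∘unlabel : ∀ y → label (unlabel y) ≡ y
    label∘unlabel y = proj₂ (injective⇒surjective label label-injective y)

    unlabel∘label : ∀ x → unlabel (label x) ≡ x
    unlabel∘label x = label-injective (label∘unlabel (label x))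

  opaque
    naturalLabelling : ∃ λ S → R ≅ S × NaturallyLabelled S
    naturalLabelling =
      (λ p q → R (unlabel p) (unlabel q)) ,
      mk≅ (label , unlabel , unlabel∘label , label∘unlabel ,
           λ x y → cong₂ R (sym (unlabel∘label x)) (sym (unlabel∘label y))) ,
      λ p q p≼q → subst₂ _≤_ (cong toℕ (label∘unlabel p)) (cong toℕ (label∘unlabel q)) (label-mono _ _ p≼q)


-- Connectivity and nullity of lattices

module _ {R : Rel n} (labelled : NaturallyLabelled R) where

  index-mono-< : ∀ {x y} → T (R x y) → x ≢ y → toℕ x < toℕ y
  index-mono-< {x} {y} x≼y x≢y with m≤n⇒m<n∨m≡n (labelled x y x≼y)
  ... | inj₁ x<y = x<y
  ... | inj₂ x≡y = ⊥-elim (x≢y (toℕ-injective x≡y))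

  comparable⇒≼ : IsPartialOrder R → ∀ {x y} → Comparable R x y → toℕ x ≤ toℕ y → T (R x y)
  comparable⇒≼ _ (inj₁ x≼y) _ = x≼y
  comparable⇒≼ po {x} {y} (inj₂ y≼x) x≤y =
    subst (T ∘ R x) (toℕ-injective (≤-antisym x≤y (labelled y x y≼x))) (proj₁ po x)

  private
    ≼⇒connected-within : ∀ d x y → toℕ y ≤ d + toℕ x → T (R x y) → Connected R x y
    ≼⇒connected-within d x y y≤d+x x≼y with x ≟ᶠ y
    ... | yes refl = ε
    ... | no x≢y with covers? R x y
    ...   | yes x⋖y = inj₁ x⋖y ◅ ε
    ...   | no ¬x⋖y with ¬covers⇒between R x≼y x≢y ¬x⋖y
    ...     | z , x≼z , z≼y , z≢x , z≢y with index-mono-< x≼z (z≢x ∘ sym) | index-mono-< z≼y z≢y | d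
    ...       | x<z | z<y | zero = ⊥-elim (≤⇒≯ y≤d+x (<-trans x<z z<y))
    ...       | x<z | z<y | suc d′ =
                  ≼⇒connected-within d′ x z (≤-pred (≤-trans z<y y≤d+x)) x≼z ◅◅
                  ≼⇒connected-within d′ z y
                    (≤-trans y≤d+x (≤-trans (≤-reflexive (sym (+-suc d′ (toℕ x)))) (+-monoʳ-≤ d′ x<z))) z≼y

  ≼⇒connected : ∀ {x y} → T (R x y) → Connected R x y
  ≼⇒connected {x} {y} = ≼⇒connected-within (toℕ y) x y (m≤m+n (toℕ y) (toℕ x))

module _ {n : ℕ} {R : Rel (suc n)} (lattice : IsLattice R) (labelled : NaturallyLabelled R) where

  zero-least : IsLeast R Fin.zero
  zero-least x with proj₂ (proj₂ (proj₂ lattice)) Fin.zero x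
  ... | w , w≼0 , w≼x , _ with toℕ-injective {i = w} {j = Fin.zero} (n≤0⇒n≡0 (labelled w Fin.zero w≼0))
  ...   | refl = w≼x

  last-greatest : IsGreatest R (Fin.fromℕ n)
  last-greatest x with proj₁ (proj₂ (proj₂ lattice)) x (Fin.fromℕ n)
  ... | w , x≼w , top≼w , _
    with toℕ-injective {i = w} {j = Fin.fromℕ n}
           (≤-antisym (subst (toℕ w ≤_) (sym (toℕ-fromℕ n)) (toℕ≤pred[n] w)) (labelled _ _ top≼w))
  ...   | refl = x≼w

module _ {R S : Rel n} (R≅S : R ≅ S) where
  private module ⇒ = ElementTransport R≅S

  connected-to : ∀ {x y} → Connected R x y → Connected S (⇒.to x) (⇒.to y)
  connected-to = gmap ⇒.to (Sum.map ⇒.covers-to ⇒.covers-to)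

lattice-connected : ∀ {n} {R : Rel n} → IsLattice R → ∀ x y → Connected R x y
lattice-connected {suc n} {R} lattice x y =
  let (S , R≅S , labelled) = naturalLabelling R (proj₁ lattice)
      S-lattice = isLattice-≅ R≅S lattice
      from-bottom : ∀ z → Connected S Fin.zero z
      from-bottom z = ≼⇒connected labelled (zero-least S-lattice labelled z)
  in subst₂ (Connected R) (_≅_.from∘to R≅S x) (_≅_.from∘to R≅S y)
       (connected-to (≅-sym R≅S) (reverse Sum.swap (from-bottom _) ◅◅ from-bottom _))

componentRep-card : ∀ {n} {R : Rel n} → IsLattice R → HasCard (ComponentRep R) 1
componentRep-card {suc n} lattice =
  Fin.zero ∷ [] , refl , [] ∷ [] ,
  λ x → (λ { (here refl) _ _ → z≤n }) ,
        (λ x-rep → here (toℕ-injective (n≤0⇒n≡0 (x-rep Fin.zero (lattice-connected lattice x Fin.zero)))))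

-- For a lattice the cover graph is connected, so nullity k means (number of covers) + 1 = n + k.
nullity⇒coverCount : ∀ {n} {R : Rel n} → IsLattice R → HasNullity R k →
                     ∃ λ M → HasCard (CoverPair R) M × M + 1 ≡ n + k
nullity⇒coverCount lattice (M , c , covers , reps , M+c≡n+k) =
  M , covers , subst (λ c → M + c ≡ _) (card-unique reps (componentRep-card lattice)) M+c≡n+k

coverCount⇒nullity : ∀ {n} {R : Rel n} {M} → IsLattice R → HasCard (CoverPair R) M → M + 1 ≡ n + k →
                     HasNullity R k
coverCount⇒nullity lattice covers M+1≡n+k = _ , 1 , covers , componentRep-card lattice , M+1≡n+k

coverCount : ∀ {n} (R : Rel n) → ∃ (HasCard (CoverPair R))
coverCount {n} R = card-decidable all-pairs (λ (x , y) → covers? R x y)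
  where
  all-pairs : HasCard (U {A = Fin n × Fin n}) _
  all-pairs = cartesianProduct (allFin n) (allFin n) , refl ,
              Unique.cartesianProduct⁺ (Unique.allFin⁺ n) (Unique.allFin⁺ n) ,
              λ (x , y) → (λ _ → tt) , (λ _ → ∈-cartesianProduct⁺ (∈-allFin x) (∈-allFin y))

rcLattice-≅ : R ≅ S → IsRCLatticeOfNullity k R → IsRCLatticeOfNullity k S
rcLattice-≅ R≅S (lattice , rc , nullity) =
  let (M , covers , M+1≡n+k) = nullity⇒coverCount lattice nullity
      S-lattice = isLattice-≅ R≅S lattice
  in S-lattice , reduciblesComparable-≅ R≅S rc , coverCount⇒nullity S-lattice (coverCount-≅ R≅S covers) M+1≡n+k

rcBlock-≅ : R ≅ S → IsRCBlockOfNullity k R → IsRCBlockOfNullity k S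
rcBlock-≅ R≅S (lattice , shape , rc , nullity) =
  let (S-lattice , S-rc , S-nullity) = rcLattice-≅ R≅S (lattice , rc , nullity)
  in S-lattice , isBlockShape-≅ R≅S shape , S-rc , S-nullity


-- Gluing a block between two chains

-- The block element sitting at index j when the block occupies the indices a, …, a + m - 1.
blockAt : (a m : ℕ) → ℕ → Maybe (Fin m)
blockAt (suc a) m       zero    = nothing
blockAt (suc a) m       (suc j) = blockAt a m j
blockAt zero    zero    j       = nothing
blockAt zero    (suc m) zero    = just Fin.zero
blockAt zero    (suc m) (suc j) = Maybe.map Fin.suc (blockAt zero m j)

-- glue n a m B is the ordinal sum (chain of a elements) ⊕ B ⊕ (chain of n - a - m elements),
-- carried by Fin n with B placed at the indices a, …, a + m - 1.
glue : (n a m : ℕ) → Rel m → Rel n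
glue n a m B x y = order (blockAt a m (toℕ x)) (blockAt a m (toℕ y))
  where
  order : Maybe (Fin m) → Maybe (Fin m) → Bool
  order (just p) (just q) = B p q
  order _        _        = toℕ x ≤ᵇ toℕ y

blockAt-inside : ∀ a {m} (p : Fin m) → blockAt a m (a + toℕ p) ≡ just p
blockAt-inside (suc a) p = blockAt-inside a p
blockAt-inside zero Fin.zero = refl
blockAt-inside zero (Fin.suc p) rewrite blockAt-inside zero p = refl

blockAt-below : ∀ a m j → j < a → blockAt a m j ≡ nothing
blockAt-below (suc a) m zero    _ = refl
blockAt-below (suc a) m (suc j) (s≤s j<a) = blockAt-below a m j j<a

blockAt-above : ∀ a m j → a + m ≤ j → blockAt a m j ≡ nothing
blockAt-above (suc a) m       (suc j) (s≤s a+m≤j) = blockAt-above a m j a+m≤j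
blockAt-above zero    zero    j       _ = refl
blockAt-above zero    (suc m) (suc j) (s≤s m≤j) rewrite blockAt-above zero m j m≤j = refl

module Placement {n a m : ℕ} (a+m≤n : a + m ≤ n) where

  emb : Fin m → Fin n
  emb p = fromℕ< (≤-trans (+-monoʳ-< a (toℕ<n p)) a+m≤n)

  toℕ-emb : ∀ p → toℕ (emb p) ≡ a + toℕ p
  toℕ-emb p = toℕ-fromℕ< _

  emb-injective : ∀ {p q} → emb p ≡ emb q → p ≡ q
  emb-injective {p} {q} eq =
    toℕ-injective (+-cancelˡ-≡ a _ _ (trans (sym (toℕ-emb p)) (trans (cong toℕ eq) (toℕ-emb q))))

  emb-lower : ∀ p → a ≤ toℕ (emb p)
  emb-lower p = subst (a ≤_) (sym (toℕ-emb p)) (m≤m+n a (toℕ p))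

  emb-upper : ∀ p → toℕ (emb p) < a + m
  emb-upper p = subst (_< a + m) (sym (toℕ-emb p)) (+-monoʳ-< a (toℕ<n p))

  Below Above Outside : Fin n → Set
  Below x = toℕ x < a
  Above x = a + m ≤ toℕ x
  Outside x = Below x ⊎ Above x

  emb-inside : ∀ p → ¬ Outside (emb p)
  emb-inside p (inj₁ below) = <⇒≱ below (emb-lower p)
  emb-inside p (inj₂ above) = <⇒≱ (emb-upper p) above

  blockAt-outside : ∀ {x} → Outside x → blockAt a m (toℕ x) ≡ nothing
  blockAt-outside {x} (inj₁ below) = blockAt-below a m (toℕ x) below
  blockAt-outside {x} (inj₂ above) = blockAt-above a m (toℕ x) above

  blockAt-emb : ∀ p → blockAt a m (toℕ (emb p)) ≡ just p
  blockAt-emb p = trans (cong (blockAt a m) (toℕ-emb p)) (blockAt-inside a p)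

  data Position : Fin n → Set where
    outside : ∀ {x} → Outside x → Position x
    inside  : ∀ p → Position (emb p)

  position : ∀ x → Position x
  position x with toℕ x <? a | toℕ x <? a + m
  ... | yes below | _ = outside (inj₁ below)
  ... | no _ | no ¬below-end = outside (inj₂ (≮⇒≥ ¬below-end))
  ... | no ¬below | yes below-end = subst Position (toℕ-injective toℕ-emb-p) (inside p)
    where
    p : Fin m
    p = fromℕ< (subst (toℕ x ∸ a <_) (m+n∸m≡n a m) (∸-monoˡ-< below-end (≮⇒≥ ¬below)))
    toℕ-emb-p : toℕ (emb p) ≡ toℕ x
    toℕ-emb-p = trans (toℕ-emb p) (trans (cong (a +_) (toℕ-fromℕ< _)) (m+[n∸m]≡n (≮⇒≥ ¬below)))

  inside-index : ∀ x → ¬ Outside x → ∃ λ p → emb p ≡ x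
  inside-index x ¬x-out with position x
  ... | outside x-out = ⊥-elim (¬x-out x-out)
  ... | inside p = p , refl

  outside-above-emb : ∀ {x} p → Outside x → toℕ (emb p) ≤ toℕ x → Above x
  outside-above-emb p (inj₁ below) p≤x = ⊥-elim (<⇒≱ below (≤-trans (emb-lower p) p≤x))
  outside-above-emb p (inj₂ above) _ = above

  outside-below-emb : ∀ {x} p → Outside x → toℕ x ≤ toℕ (emb p) → Below x
  outside-below-emb p (inj₁ below) _ = below
  outside-below-emb p (inj₂ above) x≤p = ⊥-elim (<⇒≱ (emb-upper p) (≤-trans above x≤p))

module Glued {n a m : ℕ} (a+m≤n : a + m ≤ n) (B : Rel m) where
  open Placement {n} {a} {m} a+m≤n public

  G : Rel n
  G = glue n a m B

  glue-outside : ∀ {x y} → Outside x ⊎ Outside y → G x y ≡ (toℕ x ≤ᵇ toℕ y)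
  glue-outside {x} {y} (inj₁ x-out) rewrite blockAt-outside x-out = refl
  glue-outside {x} {y} (inj₂ y-out) rewrite blockAt-outside y-out with blockAt a m (toℕ x)
  ... | just _ = refl
  ... | nothing = refl

  glue-inside : ∀ p q → G (emb p) (emb q) ≡ B p q
  glue-inside p q rewrite blockAt-emb p | blockAt-emb q = refl

  index-≤ : ∀ {x y} → Outside x ⊎ Outside y → T (G x y) → toℕ x ≤ toℕ y
  index-≤ {x} {y} out = ≤ᵇ⇒≤ (toℕ x) (toℕ y) ∘ subst T (glue-outside out)

  ≤-index : ∀ {x y} → Outside x ⊎ Outside y → toℕ x ≤ toℕ y → T (G x y)
  ≤-index out = subst T (sym (glue-outside out)) ∘ ≤⇒≤ᵇ

  block-≼ : ∀ {p q} → T (G (emb p) (emb q)) → T (B p q)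
  block-≼ {p} {q} = subst T (glue-inside p q)

  ≼-block : ∀ {p q} → T (B p q) → T (G (emb p) (emb q))
  ≼-block {p} {q} = subst T (sym (glue-inside p q))

  outside-comparable : ∀ {x} y → Outside x → Comparable G x y
  outside-comparable {x} y x-out with ≤-total (toℕ x) (toℕ y)
  ... | inj₁ x≤y = inj₁ (≤-index (inj₁ x-out) x≤y)
  ... | inj₂ y≤x = inj₂ (≤-index (inj₂ x-out) y≤x)

  module _ (B-po : IsPartialOrder B) (B-labelled : NaturallyLabelled B) where

    glue-labelled : NaturallyLabelled G
    glue-labelled x y x≼y with position x | position y
    ... | outside x-out | _             = index-≤ (inj₁ x-out) x≼y
    ... | inside p      | outside y-out = index-≤ (inj₂ y-out) x≼y
    ... | inside p      | inside q      =
      subst₂ _≤_ (sym (toℕ-emb p)) (sym (toℕ-emb q)) (+-monoʳ-≤ a (B-labelled p q (block-≼ x≼y)))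

    -- it would have to lie both above and below the block
    outside-not-between : ∀ {y} p r → Outside y → T (G (emb p) y) → T (G y (emb r)) → ⊥
    outside-not-between p r y-out p≼y y≼r =
        <⇒≱ (emb-upper r) (≤-trans (outside-above-emb p y-out (glue-labelled _ _ p≼y)) (glue-labelled _ _ y≼r))

    glue-isPartialOrder : IsPartialOrder G
    glue-isPartialOrder = reflexive , antisym , transitive
      where
      reflexive : ∀ x → T (G x x)
      reflexive x with position x
      ... | outside x-out = ≤-index (inj₁ x-out) ≤-refl
      ... | inside p = ≼-block (proj₁ B-po p)
      antisym : ∀ x y → T (G x y) → T (G y x) → x ≡ y
      antisym x y x≼y y≼x = toℕ-injective (≤-antisym (glue-labelled x y x≼y) (glue-labelled y x y≼x))
      transitive : ∀ x y z → T (G x y) → T (G y z) → T (G x z)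
      transitive x y z x≼y y≼z with position x | position z
      ... | outside x-out | _ = ≤-index (inj₁ x-out) (≤-trans (glue-labelled _ _ x≼y) (glue-labelled _ _ y≼z))
      ... | inside _ | outside z-out = ≤-index (inj₂ z-out) (≤-trans (glue-labelled _ _ x≼y) (glue-labelled _ _ y≼z))
      ... | inside p | inside r with position y
      ...   | outside y-out = ⊥-elim (outside-not-between p r y-out x≼y y≼z)
      ...   | inside q = ≼-block (proj₂ (proj₂ B-po) p q r (block-≼ x≼y) (block-≼ y≼z))

    emb-isJoin : ∀ {p q r} → IsJoin B p q r → IsJoin G (emb p) (emb q) (emb r)
    emb-isJoin {p} {q} {r} (p≼r , q≼r , r-least) = ≼-block p≼r , ≼-block q≼r , least
      where
      least : ∀ w → T (G (emb p) w) → T (G (emb q) w) → T (G (emb r) w)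
      least w p≼w q≼w with position w
      ... | inside s = ≼-block (r-least s (block-≼ p≼w) (block-≼ q≼w))
      ... | outside w-out =
        ≤-index (inj₂ w-out) (<⇒≤ (<-≤-trans (emb-upper r) (outside-above-emb p w-out (glue-labelled _ _ p≼w))))

    emb-isMeet : ∀ {p q r} → IsMeet B p q r → IsMeet G (emb p) (emb q) (emb r)
    emb-isMeet {p} {q} {r} (r≼p , r≼q , r-greatest) = ≼-block r≼p , ≼-block r≼q , greatest
      where
      greatest : ∀ w → T (G w (emb p)) → T (G w (emb q)) → T (G w (emb r))
      greatest w w≼p w≼q with position w
      ... | inside s = ≼-block (r-greatest s (block-≼ w≼p) (block-≼ w≼q))
      ... | outside w-out =
        ≤-index (inj₁ w-out) (<⇒≤ (<-≤-trans (outside-below-emb p w-out (glue-labelled _ _ w≼p)) (emb-lower r)))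

    isJoin-emb : ∀ {p q r} → IsJoin G (emb p) (emb q) (emb r) → IsJoin B p q r
    isJoin-emb (p≼r , q≼r , r-least) =
      block-≼ p≼r , block-≼ q≼r , λ s p≼s q≼s → block-≼ (r-least (emb s) (≼-block p≼s) (≼-block q≼s))

    isMeet-emb : ∀ {p q r} → IsMeet G (emb p) (emb q) (emb r) → IsMeet B p q r
    isMeet-emb (r≼p , r≼q , r-greatest) =
      block-≼ r≼p , block-≼ r≼q , λ s s≼p s≼q → block-≼ (r-greatest (emb s) (≼-block s≼p) (≼-block s≼q))

    module _ (B-lattice : IsLattice B) where
      private
        joinB = proj₁ (proj₂ (proj₂ B-lattice))
        meetB = proj₂ (proj₂ (proj₂ B-lattice))

      glue-isLattice : IsLattice G
      glue-isLattice =
        glue-isPartialOrder , ≤-trans (proj₁ (proj₂ B-lattice)) (≤-trans (m≤n+m m a) a+m≤n) , joins , meets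
        where
        joins : ∀ x y → ∃ (IsJoin G x y)
        joins x y with position x | position y
        ... | outside x-out | _ = comparable⇒join glue-isPartialOrder (outside-comparable y x-out)
        ... | inside _ | outside y-out = comparable⇒join glue-isPartialOrder (Sum.swap (outside-comparable x y-out))
        ... | inside p | inside q = let (r , J) = joinB p q in emb r , emb-isJoin J
        meets : ∀ x y → ∃ (IsMeet G x y)
        meets x y with position x | position y
        ... | outside x-out | _ = comparable⇒meet glue-isPartialOrder (outside-comparable y x-out)
        ... | inside _ | outside y-out = comparable⇒meet glue-isPartialOrder (Sum.swap (outside-comparable x y-out))
        ... | inside p | inside q = let (r , M) = meetB p q in emb r , emb-isMeet M

      -- An outside argument is comparable with the other one, so a nontrivial join or meet
      -- has both arguments in the block.
      private
        join-of-inside : ∀ {x y z} → IsJoin G y z x → y ≢ x → z ≢ x →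
                         ∃ λ q → ∃ λ r → y ≡ emb q × z ≡ emb r
        join-of-inside {y = y} {z = z} J y≢x z≢x with position y | position z
        ... | outside y-out | _ =
          ⊥-elim ([ y≢x ∘ sym , z≢x ∘ sym ]
                    (comparable⇒join-trivial glue-isPartialOrder (outside-comparable z y-out) J))
        ... | inside _ | outside z-out =
          ⊥-elim ([ y≢x ∘ sym , z≢x ∘ sym ]
                    (comparable⇒join-trivial glue-isPartialOrder (Sum.swap (outside-comparable y z-out)) J))
        ... | inside q | inside r = q , r , refl , refl

        meet-of-inside : ∀ {x y z} → IsMeet G y z x → y ≢ x → z ≢ x →
                         ∃ λ q → ∃ λ r → y ≡ emb q × z ≡ emb r
        meet-of-inside {y = y} {z = z} M y≢x z≢x with position y | position z
        ... | outside y-out | _ =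
          ⊥-elim ([ y≢x ∘ sym , z≢x ∘ sym ]
                    (comparable⇒meet-trivial glue-isPartialOrder (outside-comparable z y-out) M))
        ... | inside _ | outside z-out =
          ⊥-elim ([ y≢x ∘ sym , z≢x ∘ sym ]
                    (comparable⇒meet-trivial glue-isPartialOrder (Sum.swap (outside-comparable y z-out)) M))
        ... | inside q | inside r = q , r , refl , refl

      joinReducible-inside : ∀ {x} → JoinReducible G x → ∃ λ p → x ≡ emb p
      joinReducible-inside (y , z , y≢x , z≢x , J) with join-of-inside J y≢x z≢x
      ... | q , r , refl , refl = let (s , Js) = joinB q r in s , join-unique glue-isPartialOrder J (emb-isJoin Js)

      meetReducible-inside : ∀ {x} → MeetReducible G x → ∃ λ p → x ≡ emb p
      meetReducible-inside (y , z , y≢x , z≢x , M) with meet-of-inside M y≢x z≢x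
      ... | q , r , refl , refl = let (s , Ms) = meetB q r in s , meet-unique glue-isPartialOrder M (emb-isMeet Ms)

      reducible-inside : ∀ {x} → Reducible G x → ∃ λ p → x ≡ emb p
      reducible-inside = [ joinReducible-inside , meetReducible-inside ]

      joinReducible-emb : ∀ {p} → JoinReducible G (emb p) → JoinReducible B p
      joinReducible-emb (y , z , y≢x , z≢x , J) with join-of-inside J y≢x z≢x
      ... | q , r , refl , refl = q , r , y≢x ∘ cong emb , z≢x ∘ cong emb , isJoin-emb J

      meetReducible-emb : ∀ {p} → MeetReducible G (emb p) → MeetReducible B p
      meetReducible-emb (y , z , y≢x , z≢x , M) with meet-of-inside M y≢x z≢x
      ... | q , r , refl , refl = q , r , y≢x ∘ cong emb , z≢x ∘ cong emb , isMeet-emb M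

      emb-joinReducible : ∀ {p} → JoinReducible B p → JoinReducible G (emb p)
      emb-joinReducible (q , r , q≢p , r≢p , J) =
        emb q , emb r , q≢p ∘ emb-injective , r≢p ∘ emb-injective , emb-isJoin J

      emb-meetReducible : ∀ {p} → MeetReducible B p → MeetReducible G (emb p)
      emb-meetReducible (q , r , q≢p , r≢p , M) =
        emb q , emb r , q≢p ∘ emb-injective , r≢p ∘ emb-injective , emb-isMeet M

      glue-reduciblesComparable : ReduciblesComparable B → ReduciblesComparable G
      glue-reduciblesComparable rc x y rx ry with reducible-inside rx | reducible-inside ry
      ... | p , refl | q , refl =
        Sum.map ≼-block ≼-block (rc p q (Sum.map joinReducible-emb meetReducible-emb rx)
                                        (Sum.map joinReducible-emb meetReducible-emb ry))

      block-reduciblesComparable : ReduciblesComparable G → ReduciblesComparable B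
      block-reduciblesComparable rc p q rp rq =
        Sum.map block-≼ block-≼ (rc (emb p) (emb q) (Sum.map emb-joinReducible emb-meetReducible rp)
                                                    (Sum.map emb-joinReducible emb-meetReducible rq))

toℕ-pred : ∀ {n} (x : Fin n) → toℕ (Fin.pred x) ≡ pred (toℕ x)
toℕ-pred Fin.zero = refl
toℕ-pred (Fin.suc x) = toℕ-inject₁ x


-- Glued blocks with least element 0 and greatest element d

module GluedBounded {n a d : ℕ} (a+m≤n : a + suc d ≤ n) (B : Rel (suc d))
                   (B-po : IsPartialOrder B) (B-labelled : NaturallyLabelled B)
                   (B-bottom : IsLeast B Fin.zero) (B-top : IsGreatest B (Fin.fromℕ d)) where
  open Glued {n} {a} {suc d} a+m≤n B

  private
    G-labelled = glue-labelled B-po B-labelled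

  emb-covers : ∀ {p q} → Covers B p q → Covers G (emb p) (emb q)
  emb-covers {p} {q} (p≼q , p≢q , tight) = ≼-block p≼q , p≢q ∘ emb-injective , tight′
    where
    tight′ : ∀ z → T (G (emb p) z) → T (G z (emb q)) → z ≡ emb p ⊎ z ≡ emb q
    tight′ z p≼z z≼q with position z
    ... | inside r = Sum.map (cong emb) (cong emb) (tight r (block-≼ p≼z) (block-≼ z≼q))
    ... | outside z-out = ⊥-elim (outside-not-between B-po B-labelled p q z-out p≼z z≼q)

  covers-emb : ∀ {p q} → Covers G (emb p) (emb q) → Covers B p q
  covers-emb (p≼q , p≢q , tight) = block-≼ p≼q , p≢q ∘ cong emb ,
    λ r p≼r r≼q → Sum.map emb-injective emb-injective (tight (emb r) (≼-block p≼r) (≼-block r≼q))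

  consecutive-covers : ∀ {x y} → suc (toℕ x) ≡ toℕ y → Outside x ⊎ Outside y → Covers G x y
  consecutive-covers {x} {y} x+1≡y out =
    ≤-index out (subst (toℕ x ≤_) x+1≡y (n≤1+n _)) ,
    (λ { refl → 1+n≢n x+1≡y }) ,
    λ z x≼z z≼y → squeeze (G-labelled _ _ x≼z) (G-labelled _ _ z≼y)
    where
    squeeze : ∀ {z} → toℕ x ≤ toℕ z → toℕ z ≤ toℕ y → z ≡ x ⊎ z ≡ y
    squeeze {z} x≤z z≤y with m≤n⇒m<n∨m≡n x≤z
    ... | inj₂ x≡z = inj₁ (toℕ-injective (sym x≡z))
    ... | inj₁ x<z = inj₂ (toℕ-injective (≤-antisym z≤y (subst (_≤ toℕ z) x+1≡y x<z)))

  private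
    -- In a cover x ⋖ y, the element `next` with index suc (toℕ x) equals y as soon as it is
    -- glue-comparable with x and y, which is guaranteed when the relevant elements are outside.
    module Cover {x y} (x⋖y : Covers G x y) where
      x≼y = proj₁ x⋖y
      x≢y = proj₁ (proj₂ x⋖y)
      tight = proj₂ (proj₂ x⋖y)

      x<y : toℕ x < toℕ y
      x<y = index-mono-< G-labelled x≼y x≢y

      squeeze : ∀ {z} → T (G x z) → T (G z y) → z ≢ x → z ≡ y
      squeeze x≼z z≼y z≢x = [ ⊥-elim ∘ z≢x , (λ z≡y → z≡y) ] (tight _ x≼z z≼y)

      next : Fin n
      next = fromℕ< (<-≤-trans (s≤s x<y) (toℕ<n y))

      toℕ-next : toℕ next ≡ suc (toℕ x)
      toℕ-next = toℕ-fromℕ< _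

      via-next : Outside x ⊎ Outside next → Outside next ⊎ Outside y → suc (toℕ x) ≡ toℕ y
      via-next out₁ out₂ = trans (sym toℕ-next) (cong toℕ (squeeze x≼next next≼y next≢x))
        where
        x≼next = ≤-index out₁ (subst (toℕ x ≤_) (sym toℕ-next) (n≤1+n _))
        next≼y = ≤-index out₂ (subst (_≤ toℕ y) (sym toℕ-next) x<y)
        next≢x = λ next≡x → 1+n≢n (trans (sym toℕ-next) (cong toℕ next≡x))

    toℕ-bottom : toℕ (emb Fin.zero) ≡ a
    toℕ-bottom = trans (toℕ-emb Fin.zero) (+-identityʳ a)

    cover-from-below : ∀ {x y} → Covers G x y → Below x → suc (toℕ x) ≡ toℕ y
    cover-from-below {x} {y} x⋖y x-below with suc (toℕ x) <? a
    ... | yes next-below = via-next (inj₁ (inj₁ x-below)) (inj₁ (inj₁ (subst (_< a) (sym toℕ-next) next-below)))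
      where open Cover x⋖y
    ... | no ¬next-below = trans x+1≡a (trans (sym toℕ-bottom) (cong toℕ (squeeze x≼bottom bottom≼y bottom≢x)))
      where
      open Cover x⋖y
      x+1≡a = ≤-antisym x-below (≮⇒≥ ¬next-below)
      x≼bottom = ≤-index (inj₁ (inj₁ x-below)) (subst (toℕ x ≤_) (sym toℕ-bottom) (<⇒≤ x-below))
      bottom≢x = λ bottom≡x → <-irrefl (trans (sym (cong toℕ bottom≡x)) toℕ-bottom) x-below
      bottom≼y : T (G (emb Fin.zero) y)
      bottom≼y with position y
      ... | inside q = ≼-block (B-bottom q)
      ... | outside y-out = ≤-index (inj₂ y-out) (subst₂ _≤_ (sym toℕ-bottom) refl (subst (_≤ toℕ y) x+1≡a x<y))

    cover-from-above : ∀ {x y} → Covers G x y → Above x → suc (toℕ x) ≡ toℕ y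
    cover-from-above x⋖y x-above = via-next (inj₁ (inj₂ x-above)) (inj₁ (inj₂ next-above))
      where
      open Cover x⋖y
      next-above = subst (a + suc d ≤_) (sym toℕ-next) (≤-trans x-above (n≤1+n _))

    cover-from-block : ∀ {p y} → Covers G (emb p) y → Outside y → suc (toℕ (emb p)) ≡ toℕ y
    cover-from-block {p} p⋖y y-out with p ≟ᶠ Fin.fromℕ d
    ... | yes refl = via-next (inj₂ (inj₂ next-above)) (inj₂ y-out)
      where
      open Cover p⋖y
      toℕ-top = trans (toℕ-emb _) (cong (a +_) (toℕ-fromℕ d))
      next-above = ≤-reflexive (sym (trans toℕ-next (trans (cong suc toℕ-top) (sym (+-suc a d)))))
    ... | no p≢top = ⊥-elim (emb-inside top (subst Outside (sym top≡y) y-out))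
      where
      open Cover p⋖y
      top = Fin.fromℕ d
      top≡y = squeeze (≼-block (B-top p))
                      (≤-index (inj₂ y-out) (<⇒≤ (<-≤-trans (emb-upper top) (outside-above-emb p y-out (<⇒≤ x<y)))))
                      (p≢top ∘ sym ∘ emb-injective)

  outside-cover-consecutive : ∀ {x y} → Covers G x y → Outside x ⊎ Outside y → suc (toℕ x) ≡ toℕ y
  outside-cover-consecutive x⋖y out with position _
  outside-cover-consecutive x⋖y _           | outside (inj₁ x-below) = cover-from-below x⋖y x-below
  outside-cover-consecutive x⋖y _           | outside (inj₂ x-above) = cover-from-above x⋖y x-above
  outside-cover-consecutive x⋖y (inj₁ x-out) | inside p = ⊥-elim (emb-inside p x-out)
  outside-cover-consecutive x⋖y (inj₂ y-out) | inside p = cover-from-block x⋖y y-out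

  ChainTop : Fin n → Set
  ChainTop y = (0 < toℕ y × toℕ y ≤ a) ⊎ Above y

  private
    step : Fin n → Fin n × Fin n
    step y = Fin.pred y , y

    emb² : Fin (suc d) × Fin (suc d) → Fin n × Fin n
    emb² (p , q) = emb p , emb q

    a<a+m : a < a + suc d
    a<a+m = subst (a <_) (sym (+-suc a d)) (s≤s (m≤m+n a d))

    chainTop-positive : ∀ {y} → ChainTop y → 0 < toℕ y
    chainTop-positive (inj₁ (0<y , _)) = 0<y
    chainTop-positive (inj₂ y-above) = <-≤-trans (≤-<-trans z≤n a<a+m) y-above

    chainTop-consecutive : ∀ {y} → ChainTop y → suc (toℕ (Fin.pred y)) ≡ toℕ y
    chainTop-consecutive {y} top =
      trans (cong suc (toℕ-pred y)) (suc-pred (toℕ y) ⦃ >-nonZero (chainTop-positive top) ⦄)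

    chainTop-outside : ∀ {y} → ChainTop y → Outside (Fin.pred y) ⊎ Outside y
    chainTop-outside {y} top@(inj₁ (_ , y≤a)) = inj₁ (inj₁ (subst (_≤ a) (sym (chainTop-consecutive top)) y≤a))
    chainTop-outside (inj₂ y-above) = inj₂ (inj₂ y-above)

    consecutive-chainTop : ∀ {x y} → suc (toℕ x) ≡ toℕ y → Outside x ⊎ Outside y → ChainTop y
    consecutive-chainTop x+1≡y (inj₁ (inj₁ x-below)) =
      inj₁ (subst (0 <_) x+1≡y (s≤s z≤n) , subst (_≤ a) x+1≡y x-below)
    consecutive-chainTop x+1≡y (inj₁ (inj₂ x-above)) = inj₂ (≤-trans x-above (subst (_ ≤_) x+1≡y (n≤1+n _)))
    consecutive-chainTop x+1≡y (inj₂ (inj₁ y-below)) = inj₁ (subst (0 <_) x+1≡y (s≤s z≤n) , <⇒≤ y-below)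
    consecutive-chainTop x+1≡y (inj₂ (inj₂ y-above)) = inj₂ y-above

    inside-or-outside : ∀ x y → (∃ λ p → ∃ λ q → x ≡ emb p × y ≡ emb q) ⊎ (Outside x ⊎ Outside y)
    inside-or-outside x y with position x | position y
    ... | outside x-out | _ = inj₂ (inj₁ x-out)
    ... | inside _ | outside y-out = inj₂ (inj₂ y-out)
    ... | inside p | inside q = inj₁ (p , q , refl , refl)

  chainTop-card : HasCard ChainTop (a + (n ∸ (a + suc d)))
  chainTop-card = card-∪ (λ y ((_ , y≤a) , y-above) → <⇒≱ (≤-<-trans y≤a a<a+m) y-above) lower upper
    where
    suc-a≤n = ≤-trans a<a+m a+m≤n
    lower : HasCard (λ y → 0 < toℕ y × toℕ y ≤ a) a
    lower = card-cong ((λ (y<1+a , ¬y<1) → ≮⇒≥ ¬y<1 , ≤-pred y<1+a) , (λ (0<y , y≤a) → s≤s y≤a , ≤⇒≯ 0<y))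
              (card-∖ _≟ᶠ_ (λ y<1 → ≤-trans y<1 (s≤s z≤n))
                 (card-Fin< (≤-trans (s≤s z≤n) suc-a≤n)) (card-Fin< suc-a≤n))
    upper : HasCard Above (n ∸ (a + suc d))
    upper = card-cong ((λ (_ , ¬y<a+m) → ≮⇒≥ ¬y<a+m) , (λ y-above → tt , ≤⇒≯ y-above))
              (card-∖ _≟ᶠ_ (λ _ → tt) (card-Fin< a+m≤n) card-Fin)

  -- The covers of G are those of B together with the n - m links of the two chains.
  glue-coverCount : ∀ {M} → HasCard (CoverPair B) M → HasCard (CoverPair G) (M + (a + (n ∸ (a + suc d))))
  glue-coverCount B-covers =
    card-cong (union⊆covers , covers⊆union)
      (card-∪ disjoint (card-image emb² emb²-injective B-covers) (card-image step step-injective chainTop-card))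
    where
    emb²-injective : InjectiveOn emb² (CoverPair B)
    emb²-injective _ _ eq = let (p≡ , q≡) = ,-injective eq in cong₂ _,_ (emb-injective p≡) (emb-injective q≡)
    step-injective : InjectiveOn step ChainTop
    step-injective _ _ eq = proj₂ (,-injective eq)
    disjoint : Empty (Image emb² (CoverPair B) ∩ Image step ChainTop)
    disjoint _ (((p , q) , _ , refl) , (y , top , eq)) =
      let (p≡ , q≡) = ,-injective eq
      in [ emb-inside p ∘ subst Outside p≡ , emb-inside q ∘ subst Outside q≡ ] (chainTop-outside top)
    union⊆covers : Image emb² (CoverPair B) ∪ Image step ChainTop ⊆ CoverPair G
    union⊆covers (inj₁ (_ , p⋖q , refl)) = emb-covers p⋖q
    union⊆covers (inj₂ (_ , top , refl)) = consecutive-covers (chainTop-consecutive top) (chainTop-outside top)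
    covers⊆union : CoverPair G ⊆ Image emb² (CoverPair B) ∪ Image step ChainTop
    covers⊆union {x , y} x⋖y with inside-or-outside x y
    ... | inj₁ (p , q , refl , refl) = inj₁ ((p , q) , covers-emb x⋖y , refl)
    ... | inj₂ out = inj₂ (y , consecutive-chainTop x+1≡y out , cong (_, y) (toℕ-injective pred-y≡x))
      where
      x+1≡y = outside-cover-consecutive x⋖y out
      pred-y≡x = trans (toℕ-pred y) (cong pred (sym x+1≡y))

  private
    chains+block : a + (n ∸ (a + suc d)) + suc d ≡ n
    chains+block = trans (rearrange a (n ∸ (a + suc d)) (suc d)) (m∸n+n≡m a+m≤n)
      where
      rearrange : ∀ a t m → a + t + m ≡ t + (a + m)
      rearrange = solve-∀

    shift-nullity : ∀ {M k} r → M + r + 1 ≡ r + suc d + k → M + 1 ≡ suc d + k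
    shift-nullity {M} {k} r eq = +-cancelʳ-≡ r _ _ (trans (l M r) (trans eq (r′ r (suc d) k)))
      where
      l : ∀ M r → M + 1 + r ≡ M + r + 1
      l = solve-∀
      r′ : ∀ r m k → r + m + k ≡ m + k + r
      r′ = solve-∀

    unshift-nullity : ∀ {M k} r → M + 1 ≡ suc d + k → M + r + 1 ≡ r + suc d + k
    unshift-nullity {M} {k} r eq = trans (l M r) (trans (cong (_+ r) eq) (r′ (suc d) k r))
      where
      l : ∀ M r → M + r + 1 ≡ M + 1 + r
      l = solve-∀
      r′ : ∀ m k r → m + k + r ≡ r + m + k
      r′ = solve-∀

  module _ (B-lattice : IsLattice B) where
    private
      G-lattice = glue-isLattice B-po B-labelled B-lattice

    glue-nullity : ∀ {k} → HasNullity B k → HasNullity G k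
    glue-nullity B-nullity =
      let (M , B-covers , M+1≡m+k) = nullity⇒coverCount B-lattice B-nullity
      in coverCount⇒nullity G-lattice (glue-coverCount B-covers)
           (trans (unshift-nullity _ M+1≡m+k) (cong (_+ _) chains+block))

    block-nullity : ∀ {k} → HasNullity G k → HasNullity B k
    block-nullity G-nullity =
      let (M , B-covers) = coverCount B
          (M′ , G-covers , M′+1≡n+k) = nullity⇒coverCount G-lattice G-nullity
          M′≡ = card-unique (glue-coverCount B-covers) G-covers
      in coverCount⇒nullity B-lattice B-covers
           (shift-nullity _ (trans (cong (_+ 1) M′≡) (trans M′+1≡n+k (cong (_+ _) (sym chains+block)))))

  -- the bounds of B keep joins and meets of block elements inside the block
  block-isLattice : IsLattice G → IsLattice B
  block-isLattice (_ , _ , joins , meets) = B-po , s≤s z≤n , joinB , meetB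
    where
    joinB : ∀ p q → ∃ (IsJoin B p q)
    joinB p q with joins (emb p) (emb q)
    ... | z , J@(p≼z , _ , z-least) with position z
    ...   | inside r = r , isJoin-emb B-po B-labelled J
    ...   | outside z-out = ⊥-elim (outside-not-between B-po B-labelled p top z-out p≼z
                                         (z-least (emb top) (≼-block (B-top p)) (≼-block (B-top q))))
      where top = Fin.fromℕ d
    meetB : ∀ p q → ∃ (IsMeet B p q)
    meetB p q with meets (emb p) (emb q)
    ... | z , M@(z≼p , _ , z-greatest) with position z
    ...   | inside r = r , isMeet-emb B-po B-labelled M
    ...   | outside z-out = ⊥-elim (outside-not-between B-po B-labelled Fin.zero p z-out
                                         (z-greatest (emb Fin.zero) (≼-block (B-bottom p)) (≼-block (B-bottom q)))
                                         z≼p)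

  glue-rcLattice : ∀ {k} → IsLattice B → ReduciblesComparable B → HasNullity B k → IsRCLatticeOfNullity k G
  glue-rcLattice B-lattice rc B-nullity =
    glue-isLattice B-po B-labelled B-lattice , glue-reduciblesComparable B-po B-labelled B-lattice rc ,
    glue-nullity B-lattice B-nullity

  block-rcLattice : ∀ {k} → IsRCLatticeOfNullity k G → IsLattice B × ReduciblesComparable B × HasNullity B k
  block-rcLattice (G-lattice , rc , G-nullity) =
    B-lattice , block-reduciblesComparable B-po B-labelled B-lattice rc , block-nullity B-lattice G-nullity
    where B-lattice = block-isLattice G-lattice


-- Isomorphisms of glued blocks

T-extensional : ∀ {b c : Bool} → (T b → T c) → (T c → T b) → b ≡ c
T-extensional {false} {false} _ _ = refl
T-extensional {false} {true} _ c⇒b = ⊥-elim (c⇒b _)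
T-extensional {true} {false} b⇒c _ = ⊥-elim (b⇒c _)
T-extensional {true} {true} _ _ = refl

module _ {n a m : ℕ} (a+m≤n : a + m ≤ n) where
  open Placement {n} {a} {m} a+m≤n

  private
    lift : (Fin m → Fin m) → Fin n → Fin n
    lift h x = maybe (emb ∘ h) x (blockAt a m (toℕ x))

    lift-emb : ∀ h p → lift h (emb p) ≡ emb (h p)
    lift-emb h p rewrite blockAt-emb p = refl

    lift-outside : ∀ h {x} → Outside x → lift h x ≡ x
    lift-outside h x-out rewrite blockAt-outside x-out = refl

    lift-inverse : ∀ {h h′} → (∀ p → h′ (h p) ≡ p) → ∀ x → lift h′ (lift h x) ≡ x
    lift-inverse {h} {h′} h′∘h x with position x
    ... | outside x-out = trans (cong (lift h′) (lift-outside h x-out)) (lift-outside h′ x-out)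
    ... | inside p = trans (cong (lift h′) (lift-emb h p)) (trans (lift-emb h′ (h p)) (cong emb (h′∘h p)))

    outside-≤ᵇ-emb : ∀ {x} → Outside x → ∀ p q → (toℕ x ≤ᵇ toℕ (emb p)) ≡ (toℕ x ≤ᵇ toℕ (emb q))
    outside-≤ᵇ-emb (inj₁ x-below) p q =
      T-extensional (λ _ → ≤⇒≤ᵇ (<⇒≤ (<-≤-trans x-below (emb-lower q))))
                    (λ _ → ≤⇒≤ᵇ (<⇒≤ (<-≤-trans x-below (emb-lower p))))
    outside-≤ᵇ-emb (inj₂ x-above) p q =
      T-extensional (λ x≤p → ⊥-elim (<⇒≱ (emb-upper p) (≤-trans x-above (≤ᵇ⇒≤ _ _ x≤p))))
                    (λ x≤q → ⊥-elim (<⇒≱ (emb-upper q) (≤-trans x-above (≤ᵇ⇒≤ _ _ x≤q))))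

    emb-≤ᵇ-outside : ∀ {y} → Outside y → ∀ p q → (toℕ (emb p) ≤ᵇ toℕ y) ≡ (toℕ (emb q) ≤ᵇ toℕ y)
    emb-≤ᵇ-outside (inj₁ y-below) p q =
      T-extensional (λ p≤y → ⊥-elim (<⇒≱ y-below (≤-trans (emb-lower p) (≤ᵇ⇒≤ _ _ p≤y))))
                    (λ q≤y → ⊥-elim (<⇒≱ y-below (≤-trans (emb-lower q) (≤ᵇ⇒≤ _ _ q≤y))))
    emb-≤ᵇ-outside (inj₂ y-above) p q =
      T-extensional (λ _ → ≤⇒≤ᵇ (<⇒≤ (<-≤-trans (emb-upper q) y-above)))
                    (λ _ → ≤⇒≤ᵇ (<⇒≤ (<-≤-trans (emb-upper p) y-above)))

  glue-cong : ∀ {B B′ : Rel m} → B ≅ B′ → glue n a m B ≅ glue n a m B′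
  glue-cong {B} {B′} B≅B′ = mk≅ (lift to , lift from , lift-inverse from∘to , lift-inverse to∘from , homo′)
    where
    open _≅_ B≅B′
    module G = Glued {n} {a} {m} a+m≤n B
    module G′ = Glued {n} {a} {m} a+m≤n B′
    homo′ : ∀ x y → glue n a m B x y ≡ glue n a m B′ (lift to x) (lift to y)
    homo′ x y with position x | position y
    ... | inside p | inside q = begin
      G.G (emb p) (emb q)                     ≡⟨ G.glue-inside p q ⟩
      B p q                                   ≡⟨ homo p q ⟩
      B′ (to p) (to q)                        ≡⟨ sym (G′.glue-inside (to p) (to q)) ⟩
      G′.G (emb (to p)) (emb (to q))          ≡⟨ sym (cong₂ G′.G (lift-emb to p) (lift-emb to q)) ⟩
      G′.G (lift to (emb p)) (lift to (emb q)) ∎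
      where open ≡-Reasoning
    ... | outside x-out | outside y-out rewrite lift-outside to x-out | lift-outside to y-out =
      trans (G.glue-outside (inj₁ x-out)) (sym (G′.glue-outside (inj₁ x-out)))
    ... | outside x-out | inside q rewrite lift-outside to x-out | lift-emb to q =
      trans (G.glue-outside (inj₁ x-out)) (trans (outside-≤ᵇ-emb x-out q (to q)) (sym (G′.glue-outside (inj₁ x-out))))
    ... | inside p | outside y-out rewrite lift-emb to p | lift-outside to y-out =
      trans (G.glue-outside (inj₂ y-out)) (trans (emb-≤ᵇ-outside y-out p (to p)) (sym (G′.glue-outside (inj₂ y-out))))

BelowAllMeetReducible : ∀ {n} → Rel n → Fin n → Set
BelowAllMeetReducible R x = ∀ y → MeetReducible R y → T (R x y) × x ≢ y

AboveAllJoinReducible : ∀ {n} → Rel n → Fin n → Set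
AboveAllJoinReducible R x = ∀ y → JoinReducible R y → T (R y x) × y ≢ x

module _ {n : ℕ} {R S : Rel n} (R≅S : R ≅ S) where
  private
    module ⇒ = ElementTransport R≅S
    module ⇐ = ElementTransport (≅-sym R≅S)

  belowAllMeetReducible-to : ∀ {x} → BelowAllMeetReducible R x → BelowAllMeetReducible S (⇒.to x)
  belowAllMeetReducible-to x-below = ⇒.onto λ y y-mr →
    let (x≼y , x≢y) = x-below y (subst (MeetReducible R) (⇒.from∘to y) (⇐.meetReducible-to y-mr))
    in ⇒.≼-to x≼y , x≢y ∘ ⇒.to-injective

  aboveAllJoinReducible-to : ∀ {x} → AboveAllJoinReducible R x → AboveAllJoinReducible S (⇒.to x)
  aboveAllJoinReducible-to x-above = ⇒.onto λ y y-jr →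
    let (y≼x , y≢x) = x-above y (subst (JoinReducible R) (⇒.from∘to y) (⇐.joinReducible-to y-jr))
    in ⇒.≼-to y≼x , y≢x ∘ ⇒.to-injective

card-≅ : ∀ {n c} {P : ∀ {n} → Rel n → Fin n → Set} →
         (∀ {n} {R S : Rel n} (R≅S : R ≅ S) {x} → P R x → P S (_≅_.to R≅S x)) →
         {R S : Rel n} → R ≅ S → HasCard (P R) c → HasCard (P S) c
card-≅ {P = P} P-to {R} {S} R≅S =
  card-cong ((λ { (x , px , refl) → P-to R≅S px }) ,
             (λ {y} py → ⇐.to y , P-to (≅-sym R≅S) py , ⇒.to∘from y))
  ∘ card-image ⇒.to (λ _ _ → ⇒.to-injective)
  where
  module ⇒ = ElementTransport R≅S
  module ⇐ = ElementTransport (≅-sym R≅S)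

IsLabelledBlock : ∀ {m} → Rel m → Set
IsLabelledBlock B = IsLattice B × IsBlockShape B × NaturallyLabelled B

module GluedBlock {n a d : ℕ} (a+m≤n : a + suc d ≤ n) {B : Rel (suc d)}
                  (B-block : IsLabelledBlock B) where
  open Glued {n} {a} {suc d} a+m≤n B
  private
    B-lattice = proj₁ B-block
    B-shape = proj₁ (proj₂ B-block)
    B-labelled = proj₂ (proj₂ B-block)
    B-po = proj₁ B-lattice
    bottom top : Fin (suc d)
    bottom = Fin.zero
    top = Fin.fromℕ d
    B-bottom : IsLeast B bottom
    B-bottom = zero-least B-lattice B-labelled
    B-top : IsGreatest B top
    B-top = last-greatest B-lattice B-labelled
    G-labelled = glue-labelled B-po B-labelled
    bottom-meetReducible = emb-meetReducible B-po B-labelled B-lattice (proj₂ B-shape bottom B-bottom)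
    top-joinReducible = emb-joinReducible B-po B-labelled B-lattice (proj₁ B-shape top B-top)

  below⇒belowAll : ∀ {x} → Below x → BelowAllMeetReducible G x
  below⇒belowAll x-below y y-mr with meetReducible-inside B-po B-labelled B-lattice y-mr
  ... | p , refl = ≤-index (inj₁ (inj₁ x-below)) (<⇒≤ (<-≤-trans x-below (emb-lower p))) ,
                   λ { refl → emb-inside p (inj₁ x-below) }

  belowAll⇒below : ∀ {x} → BelowAllMeetReducible G x → Below x
  belowAll⇒below {x} x-below with x-below (emb bottom) bottom-meetReducible | position x
  ... | _ | outside (inj₁ x-below′) = x-below′
  ... | x≼bottom , _ | outside (inj₂ x-above) =
    ⊥-elim (<⇒≱ (emb-upper bottom) (≤-trans x-above (G-labelled _ _ x≼bottom)))
  ... | p≼bottom , p≢bottom | inside p =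
    ⊥-elim (p≢bottom (cong emb (proj₁ (proj₂ B-po) p bottom (block-≼ p≼bottom) (B-bottom p))))

  above⇒aboveAll : ∀ {x} → Above x → AboveAllJoinReducible G x
  above⇒aboveAll x-above y y-jr with joinReducible-inside B-po B-labelled B-lattice y-jr
  ... | p , refl = ≤-index (inj₂ (inj₂ x-above)) (<⇒≤ (<-≤-trans (emb-upper p) x-above)) ,
                   λ { refl → emb-inside p (inj₂ x-above) }

  aboveAll⇒above : ∀ {x} → AboveAllJoinReducible G x → Above x
  aboveAll⇒above {x} x-above with x-above (emb top) top-joinReducible | position x
  ... | _ | outside (inj₂ x-above′) = x-above′
  ... | top≼x , _ | outside (inj₁ x-below) =
    ⊥-elim (<⇒≱ x-below (≤-trans (emb-lower top) (G-labelled _ _ top≼x)))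
  ... | top≼p , top≢p | inside p =
    ⊥-elim (top≢p (cong emb (proj₁ (proj₂ B-po) top p (block-≼ top≼p) (B-top p))))

  lowerChain-card : HasCard (BelowAllMeetReducible G) a
  lowerChain-card = card-cong (below⇒belowAll , belowAll⇒below) (card-Fin< (≤-trans (m≤m+n a (suc d)) a+m≤n))

  upperChain-card : HasCard (AboveAllJoinReducible G) (n ∸ (a + suc d))
  upperChain-card = card-cong ((λ (_ , ¬x<a+m) → above⇒aboveAll (≮⇒≥ ¬x<a+m)) ,
                               (λ x-above → tt , ≤⇒≯ (aboveAll⇒above x-above)))
                      (card-∖ _≟ᶠ_ (λ _ → tt) (card-Fin< a+m≤n) card-Fin)

  outside⇒chain : ∀ {x} → Outside x → BelowAllMeetReducible G x ⊎ AboveAllJoinReducible G x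
  outside⇒chain = Sum.map below⇒belowAll above⇒aboveAll

  chain⇒outside : ∀ {x} → BelowAllMeetReducible G x ⊎ AboveAllJoinReducible G x → Outside x
  chain⇒outside = Sum.map belowAll⇒below aboveAll⇒above

glue-shape-unique : ∀ {n a a′ d d′} {B : Rel (suc d)} {B′ : Rel (suc d′)}
                    (a+m≤n : a + suc d ≤ n) (a′+m′≤n : a′ + suc d′ ≤ n) →
                    IsLabelledBlock B → IsLabelledBlock B′ →
                    glue n a (suc d) B ≅ glue n a′ (suc d′) B′ → a ≡ a′ × d ≡ d′
glue-shape-unique {n} {a} {a′} {d} {d′} a+m≤n a′+m′≤n B-block B′-block G≅G′ =
  a≡a′ , suc-injective (+-cancelˡ-≡ a′ _ _ (∸-cancelˡ-≡ (subst (λ a → a + suc d ≤ n) a≡a′ a+m≤n) a′+m′≤n upper≡))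
  where
  module G = GluedBlock a+m≤n B-block
  module G′ = GluedBlock a′+m′≤n B′-block
  a≡a′ : a ≡ a′
  a≡a′ = card-unique (card-≅ belowAllMeetReducible-to G≅G′ G.lowerChain-card) G′.lowerChain-card
  upper≡ : n ∸ (a′ + suc d) ≡ n ∸ (a′ + suc d′)
  upper≡ = subst (λ a → n ∸ (a + suc d) ≡ _) a≡a′
             (card-unique (card-≅ aboveAllJoinReducible-to G≅G′ G.upperChain-card) G′.upperChain-card)

module _ {n a d : ℕ} (a+m≤n : a + suc d ≤ n) where
  open Placement {n} {a} {suc d} a+m≤n

  private
    -- an isomorphism of glued blocks maps the chains to the chains, hence the block to the block
    block-to-block : ∀ {B B′ : Rel (suc d)} → IsLabelledBlock B → IsLabelledBlock B′ →
                     (G≅G′ : glue n a (suc d) B ≅ glue n a (suc d) B′) →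
                     ∀ p → ∃ λ q → emb q ≡ _≅_.to G≅G′ (emb p)
    block-to-block B-block B′-block G≅G′ p = inside-index _ λ out →
      emb-inside p
        (subst Outside (from∘to (emb p))
           (GluedBlock.chain⇒outside a+m≤n B-block
              (Sum.map (belowAllMeetReducible-to (≅-sym G≅G′)) (aboveAllJoinReducible-to (≅-sym G≅G′))
                 (GluedBlock.outside⇒chain a+m≤n B′-block out))))
      where open _≅_ G≅G′

  glue-injective : ∀ {B B′ : Rel (suc d)} → IsLabelledBlock B → IsLabelledBlock B′ →
                   glue n a (suc d) B ≅ glue n a (suc d) B′ → B ≅ B′
  glue-injective {B} {B′} B-block B′-block G≅G′ = mk≅ (h , h′ , h′∘h , h∘h′ , homo′)
    where
    open _≅_ G≅G′
    module G = Glued {n} {a} {suc d} a+m≤n B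
    module G′ = Glued {n} {a} {suc d} a+m≤n B′
    forward = block-to-block B-block B′-block G≅G′
    backward = block-to-block B′-block B-block (≅-sym G≅G′)
    h h′ : Fin (suc d) → Fin (suc d)
    h p = proj₁ (forward p)
    h′ q = proj₁ (backward q)
    h′∘h : ∀ p → h′ (h p) ≡ p
    h′∘h p = emb-injective (trans (proj₂ (backward (h p))) (trans (cong from (proj₂ (forward p))) (from∘to (emb p))))
    h∘h′ : ∀ q → h (h′ q) ≡ q
    h∘h′ q = emb-injective (trans (proj₂ (forward (h′ q))) (trans (cong to (proj₂ (backward q))) (to∘from (emb q))))
    homo′ : ∀ p q → B p q ≡ B′ (h p) (h q)
    homo′ p q = begin
      B p q                          ≡⟨ sym (G.glue-inside p q) ⟩
      G.G (emb p) (emb q)            ≡⟨ homo (emb p) (emb q) ⟩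
      G′.G (to (emb p)) (to (emb q)) ≡⟨ sym (cong₂ G′.G (proj₂ (forward p)) (proj₂ (forward q))) ⟩
      G′.G (emb (h p)) (emb (h q))   ≡⟨ G′.glue-inside (h p) (h q) ⟩
      B′ (h p) (h q)                 ∎
      where open ≡-Reasoning


-- Few covers: chains and blocks

comparable-covers-unique : Comparable R y y′ → Covers R x y → Covers R x y′ → y ≡ y′
comparable-covers-unique (inj₁ y≼y′) (x≼y , x≢y , _) (_ , _ , tight′) =
  [ ⊥-elim ∘ x≢y ∘ sym , (λ y≡y′ → y≡y′) ] (tight′ _ x≼y y≼y′)
comparable-covers-unique (inj₂ y′≼y) (_ , _ , tight) (x≼y′ , x≢y′ , _) =
  [ ⊥-elim ∘ x≢y′ ∘ sym , sym ] (tight _ x≼y′ y′≼y)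

comparable-lower-covers-unique : Comparable R x x′ → Covers R x y → Covers R x′ y → x ≡ x′
comparable-lower-covers-unique (inj₁ x≼x′) (_ , _ , tight) (x′≼y , x′≢y , _) =
  [ sym , ⊥-elim ∘ x′≢y ] (tight _ x≼x′ x′≼y)
comparable-lower-covers-unique (inj₂ x′≼x) (x≼y , x≢y , _) (_ , _ , tight′) =
  [ (λ x≡x′ → x≡x′) , ⊥-elim ∘ x≢y ] (tight′ _ x′≼x x≼y)

module _ {R : Rel n} (lattice : IsLattice R) where

  -- the meet of two upper covers of x is x or one of them
  upper-cover-unique : ¬ MeetReducible R x → Covers R x y → Covers R x y′ → y ≡ y′
  upper-cover-unique ¬mr x⋖y@(x≼y , x≢y , tight) x⋖y′@(x≼y′ , x≢y′ , _)
    with proj₂ (proj₂ (proj₂ lattice)) _ _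
  ... | w , M@(w≼y , w≼y′ , w-greatest) with tight w (w-greatest _ x≼y x≼y′) w≼y
  ...   | inj₁ refl = ⊥-elim (¬mr (_ , _ , x≢y ∘ sym , x≢y′ ∘ sym , M))
  ...   | inj₂ refl = comparable-covers-unique (inj₁ w≼y′) x⋖y x⋖y′

  lower-cover-unique : ¬ JoinReducible R y → Covers R x y → Covers R x′ y → x ≡ x′
  lower-cover-unique ¬jr x⋖y@(x≼y , x≢y , tight) x′⋖y@(x′≼y , x′≢y , _)
    with proj₁ (proj₂ (proj₂ lattice)) _ _
  ... | w , J@(x≼w , x′≼w , w-least) with tight w x≼w (w-least _ x≼y x′≼y)
  ...   | inj₂ refl = ⊥-elim (¬jr (_ , _ , x≢y , x′≢y , J))
  ...   | inj₁ refl = comparable-lower-covers-unique (inj₂ x′≼w) x⋖y x′⋖y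

-- In a chain a cover is determined by its lower end, which is never the top.
chain-coverCount : ∀ {M} {R : Rel (suc n)} → NaturallyLabelled R → (∀ x y → Comparable R x y) →
                   HasCard (CoverPair R) M → M + 1 ≤ suc n
chain-coverCount {n} {R = R} labelled chain covers =
  card-injection-avoiding _≟ᶠ_ proj₁
    (λ x⋖y x′⋖y′ x≡x′ → same-lower-end x≡x′ x⋖y x′⋖y′)
    ([] ∷ []) ((λ (x≼y , x≢y , _) x≡top → not-top x≡top x≼y x≢y) ∷ []) covers card-Fin
  where
  same-lower-end : ∀ {x y x′ y′} → x ≡ x′ → Covers R x y → Covers R x′ y′ → (x , y) ≡ (x′ , y′)
  same-lower-end refl x⋖y x⋖y′ = cong (_ ,_) (comparable-covers-unique (chain _ _) x⋖y x⋖y′)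
  not-top : ∀ {x y} → x ≡ Fin.fromℕ n → T (R x y) → x ≢ y → ⊥
  not-top {y = y} refl x≼y x≢y =
    <⇒≱ (index-mono-< labelled x≼y x≢y) (subst (toℕ y ≤_) (sym (toℕ-fromℕ n)) (toℕ≤pred[n] y))

module _ {k d : ℕ} {B : Rel (suc d)} (labelled : NaturallyLabelled B)
         (block : IsRCBlockOfNullity k B) where
  private
    lattice = proj₁ block
    top-joinReducible = proj₁ (proj₁ (proj₂ block))
    bottom-meetReducible = proj₂ (proj₁ (proj₂ block))
    rc = proj₁ (proj₂ (proj₂ block))
    nullity = proj₂ (proj₂ (proj₂ block))
    antisym≼ = proj₁ (proj₂ (proj₁ lattice))
    bottom top : Fin (suc d)
    bottom = Fin.zero
    top = Fin.fromℕ d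
    B-bottom : IsLeast B bottom
    B-bottom = zero-least lattice labelled
    B-top : IsGreatest B top
    B-top = last-greatest lattice labelled
    top-reducible : Reducible B top
    top-reducible = inj₁ (top-joinReducible top B-top)
    bottom-reducible : Reducible B bottom
    bottom-reducible = inj₂ (bottom-meetReducible bottom B-bottom)

    -- A cover x ⋖ y is recorded by an end that determines it, with a tag.
    data CoverKind (x y : Fin (suc d)) : Set where
      lower-irreducible : ¬ Reducible B x → CoverKind x y
      upper-irreducible : Reducible B x → ¬ Reducible B y → CoverKind x y
      both-reducible    : Reducible B x → Reducible B y → CoverKind x y

    kind : ∀ x y → CoverKind x y
    kind x y with reducible? B x | reducible? B y
    ... | no ¬rx | _      = lower-irreducible ¬rx
    ... | yes rx | no ¬ry = upper-irreducible rx ¬ry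
    ... | yes rx | yes ry = both-reducible rx ry

    code : ∀ {x y} → CoverKind x y → Fin (suc d) × Bool
    code {x} {y} (lower-irreducible _)   = x , true
    code {x} {y} (upper-irreducible _ _) = y , false
    code {x} {y} (both-reducible _ _)    = x , false

    encode : Fin (suc d) × Fin (suc d) → Fin (suc d) × Bool
    encode (x , y) = code (kind x y)

    code-injective : ∀ {x y x′ y′} → Covers B x y → Covers B x′ y′ → (κ : CoverKind x y) (κ′ : CoverKind x′ y′) →
                     code κ ≡ code κ′ → (x , y) ≡ (x′ , y′)
    code-injective x⋖y x⋖y′ (lower-irreducible ¬rx) (lower-irreducible _) refl =
      cong (_ ,_) (upper-cover-unique lattice (¬rx ∘ inj₂) x⋖y x⋖y′)
    code-injective x⋖y x′⋖y (upper-irreducible _ ¬ry) (upper-irreducible _ _) refl =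
      cong (_, _) (lower-cover-unique lattice (¬ry ∘ inj₁) x⋖y x′⋖y)
    code-injective x⋖y x⋖y′ (both-reducible _ ry) (both-reducible _ ry′) refl =
      cong (_ ,_) (comparable-covers-unique (rc _ _ ry ry′) x⋖y x⋖y′)
    code-injective _ _ (upper-irreducible _ ¬ry) (both-reducible rx′ _) refl = ⊥-elim (¬ry rx′)
    code-injective _ _ (both-reducible rx _) (upper-irreducible _ ¬ry′) refl = ⊥-elim (¬ry′ rx)
    code-injective _ _ (lower-irreducible _) (upper-irreducible _ _) ()
    code-injective _ _ (lower-irreducible _) (both-reducible _ _) ()
    code-injective _ _ (upper-irreducible _ _) (lower-irreducible _) ()
    code-injective _ _ (both-reducible _ _) (lower-irreducible _) ()

    encode-injective : InjectiveOn encode (CoverPair B)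
    encode-injective {x , y} {x′ , y′} x⋖y x′⋖y′ = code-injective x⋖y x′⋖y′ (kind x y) (kind x′ y′)

    Missed : Fin (suc d) × Bool → Set
    Missed e = ∀ {x y} → Covers B x y → (κ : CoverKind x y) → code κ ≢ e

    missed : ∀ {e} → Missed e → ∀ {p} → CoverPair B p → encode p ≢ e
    missed e-missed {x , y} x⋖y = e-missed x⋖y (kind x y)

    reducible-missed : ∀ {c} → Reducible B c → Missed (c , true)
    reducible-missed rc _ (lower-irreducible ¬rx) refl = ¬rx rc

    top-missed : Missed (top , false)
    top-missed _ (upper-irreducible _ ¬ry) refl = ¬ry top-reducible
    top-missed (top≼y , top≢y , _) (both-reducible _ _) refl = top≢y (antisym≼ _ _ top≼y (B-top _))

    bottom≢top : bottom ≢ top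
    bottom≢top bottom≡top with bottom-meetReducible bottom B-bottom
    ... | p , _ , p≢bottom , _ = p≢bottom (antisym≼ _ _ (subst (T ∘ B p) (sym bottom≡top) (B-top p)) (B-bottom p))

    -- If bottom and top are the only reducible elements, bottom has no cover recorded as (bottom , false):
    -- a cover bottom ⋖ top would force bottom = top ∧ top.
    bottom-missed : (∀ y → Reducible B y → y ≡ bottom ⊎ y ≡ top) → Missed (bottom , false)
    bottom-missed _ (x≼b , x≢b , _) (upper-irreducible _ _) refl = x≢b (antisym≼ _ _ x≼b (B-bottom _))
    bottom-missed only (_ , b≢y , tight) (both-reducible _ ry) refl with only _ ry
    ... | inj₁ refl = b≢y refl
    ... | inj₂ refl with bottom-meetReducible bottom B-bottom
    ...   | p , q , p≢b , q≢b , (_ , _ , b-greatest)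
      with tight p (B-bottom p) (B-top p) | tight q (B-bottom q) (B-top q)
    ...     | inj₁ p≡b | _ = p≢b p≡b
    ...     | _ | inj₁ q≡b = q≢b q≡b
    ...     | inj₂ refl | inj₂ refl = b≢y (antisym≼ _ _ (B-bottom top) (b-greatest top (B-top top) (B-top top)))

    fourth-missed : ∃ λ e → Missed e × (top , true) ≢ e × (top , false) ≢ e × (bottom , true) ≢ e
    fourth-missed with any? (λ c → reducible? B c ×-dec ¬? (c ≟ᶠ bottom) ×-dec ¬? (c ≟ᶠ top))
    ... | yes (c , rc , c≢b , c≢t) =
      (c , true) , reducible-missed rc , c≢t ∘ sym ∘ cong proj₁ , (λ ()) , c≢b ∘ sym ∘ cong proj₁
    ... | no none = (bottom , false) , bottom-missed only , (λ ()) , bottom≢top ∘ sym ∘ cong proj₁ , (λ ())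
      where
      only : ∀ y → Reducible B y → y ≡ bottom ⊎ y ≡ top
      only y ry with y ≟ᶠ bottom | y ≟ᶠ top
      ... | yes y≡b | _ = inj₁ y≡b
      ... | no _ | yes y≡t = inj₂ y≡t
      ... | no y≢b | no y≢t = ⊥-elim (none (y , ry , y≢b , y≢t))

  -- Covers inject into Fin m × Bool missing four values, so (m + k - 1) + 4 ≤ 2m.
  private
    covers+4≤ : ∀ {M e} → HasCard (CoverPair B) M → Missed e →
                (top , true) ≢ e → (top , false) ≢ e → (bottom , true) ≢ e → M + 4 ≤ suc d + suc d
    covers+4≤ covers e-missed tt≢e tf≢e bt≢e = card-injection-avoiding (≡-dec _≟ᶠ_ _≟ᵇ_) encode encode-injective
      (((λ ()) ∷ (bottom≢top ∘ sym ∘ cong proj₁) ∷ tt≢e ∷ []) ∷ ((λ ()) ∷ tf≢e ∷ []) ∷ (bt≢e ∷ []) ∷ [] ∷ [])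
      (missed (reducible-missed top-reducible) ∷ missed top-missed ∷
       missed (reducible-missed bottom-reducible) ∷ missed e-missed ∷ [])
      covers (card-×Bool card-Fin)

    M+4≡m+k+3 : ∀ {M} → M + 1 ≡ suc d + k → M + 4 ≡ suc d + (k + 3)
    M+4≡m+k+3 {M} M+1≡m+k = begin
      M + 4            ≡⟨ sym (+-assoc M 1 3) ⟩
      M + 1 + 3        ≡⟨ cong (_+ 3) M+1≡m+k ⟩
      suc d + k + 3    ≡⟨ +-assoc (suc d) k 3 ⟩
      suc d + (k + 3)  ∎
      where open ≡-Reasoning

  block-size : k + 3 ≤ suc d
  block-size =
    let (M , covers , M+1≡m+k) = nullity⇒coverCount lattice nullity
        (e , e-missed , tt≢e , tf≢e , bt≢e) = fourth-missed
    in +-cancelˡ-≤ (suc d) _ _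
         (subst (_≤ suc d + suc d) (M+4≡m+k+3 M+1≡m+k) (covers+4≤ covers e-missed tt≢e tf≢e bt≢e))


-- Decomposing an RC lattice of positive nullity

least-index : ∀ {P : Fin n → Set} → Decidable P → ∃ P → ∃ λ u → P u × ∀ x → toℕ x < toℕ u → ¬ P x
least-index {suc n} P? (w , pw) with P? Fin.zero
... | yes p0 = Fin.zero , p0 , λ x ()
... | no ¬p0 with w
...   | Fin.zero = ⊥-elim (¬p0 pw)
...   | Fin.suc w′ with least-index (P? ∘ Fin.suc) (w′ , pw)
...     | u , pu , u-least = Fin.suc u , pu , λ { Fin.zero _ → ¬p0 ; (Fin.suc x) (s≤s x<u) → u-least x x<u }

greatest-index : ∀ {P : Fin n → Set} → Decidable P → ∃ P → ∃ λ v → P v × ∀ x → toℕ v < toℕ x → ¬ P x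
greatest-index {suc n} P? (w , pw) with any? (P? ∘ Fin.suc)
... | yes found with greatest-index (P? ∘ Fin.suc) found
...   | v , pv , v-greatest = Fin.suc v , pv , λ { (Fin.suc x) (s≤s v<x) → v-greatest x v<x }
greatest-index {suc n} P? (Fin.zero , p0) | no none = Fin.zero , p0 , λ { (Fin.suc x) _ → none ∘ (x ,_) }
greatest-index {suc n} P? (Fin.suc w , pw) | no none = ⊥-elim (none (w , pw))

restrict : ∀ {n a m} → a + m ≤ n → Rel n → Rel m
restrict {n} {a} {m} a+m≤n L p q = L (Placement.emb {n} {a} {m} a+m≤n p) (Placement.emb {n} {a} {m} a+m≤n q)

module _ {n a m : ℕ} (a+m≤n : a + m ≤ n) {L : Rel n} (po : IsPartialOrder L) (labelled : NaturallyLabelled L) where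
  open Placement {n} {a} {m} a+m≤n
  private
    B : Rel m
    B = restrict a+m≤n L
    module G = Glued {n} {a} {m} a+m≤n B

  restrict-isPartialOrder : IsPartialOrder B
  restrict-isPartialOrder = let (refl≼ , antisym≼ , trans≼) = po in
    (λ p → refl≼ (emb p)) ,
    (λ p q p≼q q≼p → emb-injective (antisym≼ _ _ p≼q q≼p)) ,
    (λ p q r → trans≼ (emb p) (emb q) (emb r))

  restrict-labelled : NaturallyLabelled B
  restrict-labelled p q p≼q = +-cancelˡ-≤ a _ _ (subst₂ _≤_ (toℕ-emb p) (toℕ-emb q) (labelled _ _ p≼q))

  ≗-glue-restrict : (∀ {x} → Outside x → ∀ y → Comparable L x y) → ∀ x y → L x y ≡ glue n a m B x y
  ≗-glue-restrict outside-comparable x y with position x | position y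
  ... | inside p | inside q = sym (G.glue-inside p q)
  ... | outside x-out | _ =
    T-extensional (G.≤-index (inj₁ x-out) ∘ labelled x y)
                  (comparable⇒≼ labelled po (outside-comparable x-out y) ∘ G.index-≤ (inj₁ x-out))
  ... | inside _ | outside y-out =
    T-extensional (G.≤-index (inj₂ y-out) ∘ labelled x y)
                  (comparable⇒≼ labelled po (Sum.swap (outside-comparable y-out x)) ∘ G.index-≤ (inj₂ y-out))

module Decomposition {n k : ℕ} {L : Rel (suc n)} (labelled : NaturallyLabelled L)
                     (L-rc : IsRCLatticeOfNullity k L) (k≥1 : 1 ≤ k) where
  private
    lattice = proj₁ L-rc
    nullity = proj₂ (proj₂ L-rc)
    po = proj₁ lattice
    refl≼ = proj₁ po
    joinL = proj₁ (proj₂ (proj₂ lattice))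
    meetL = proj₂ (proj₂ (proj₂ lattice))

  not-chain : ¬ (∀ x y → Comparable L x y)
  not-chain chain =
    let (M , covers , M+1≡n+k) = nullity⇒coverCount lattice nullity
    in <⇒≱ (m<m+n (suc n) k≥1) (subst (_≤ suc n) M+1≡n+k (chain-coverCount labelled chain covers))

  private
    incomparable-pair : ∃ λ x → ∃ λ y → ¬ Comparable L x y
    incomparable-pair =
      let (x , ¬x-comparable) = ¬∀⟶∃¬ _ _ (λ x → all? (comparable? L x)) not-chain
          (y , x∥y) = ¬∀⟶∃¬ _ _ (comparable? L x) ¬x-comparable
      in x , y , x∥y

    x₀ = proj₁ incomparable-pair
    y₀ = proj₁ (proj₂ incomparable-pair)
    x₀∥y₀ = proj₂ (proj₂ incomparable-pair)
    w₀ = proj₁ (meetL x₀ y₀)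
    j₀ = proj₁ (joinL x₀ y₀)
    w₀-meetReducible = incomparable⇒meetReducible po x₀∥y₀ (proj₂ (meetL x₀ y₀))
    j₀-joinReducible = incomparable⇒joinReducible po x₀∥y₀ (proj₂ (joinL x₀ y₀))

  -- opaque, so that the type checker never unfolds the searches
  private opaque
    u v : Fin (suc n)
    u = proj₁ (least-index (meetReducible? L) (w₀ , w₀-meetReducible))
    v = proj₁ (greatest-index (joinReducible? L) (j₀ , j₀-joinReducible))

    u-least : ∀ x → toℕ x < toℕ u → ¬ MeetReducible L x
    u-least = proj₂ (proj₂ (least-index (meetReducible? L) (w₀ , w₀-meetReducible)))

    v-greatest : ∀ x → toℕ v < toℕ x → ¬ JoinReducible L x
    v-greatest = proj₂ (proj₂ (greatest-index (joinReducible? L) (j₀ , j₀-joinReducible)))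

    u-meetReducible : MeetReducible L u
    u-meetReducible = proj₁ (proj₂ (least-index (meetReducible? L) (w₀ , w₀-meetReducible)))

    v-joinReducible : JoinReducible L v
    v-joinReducible = proj₁ (proj₂ (greatest-index (joinReducible? L) (j₀ , j₀-joinReducible)))

  private
    before-u-comparable : ∀ {x} → toℕ x < toℕ u → ∀ y → Comparable L x y
    before-u-comparable {x} x<u y = decidable-stable (comparable? L x y) λ x∥y →
      let (w , M) = meetL x y in
      u-least w (≤-<-trans (labelled _ _ (proj₁ M)) x<u) (incomparable⇒meetReducible po x∥y M)

    after-v-comparable : ∀ {x} → toℕ v < toℕ x → ∀ y → Comparable L x y
    after-v-comparable {x} v<x y = decidable-stable (comparable? L x y) λ x∥y →
      let (j , J) = joinL x y in
      v-greatest j (<-≤-trans v<x (labelled _ _ (proj₁ J))) (incomparable⇒joinReducible po x∥y J)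

    u≤v : toℕ u ≤ toℕ v
    u≤v = ≤-trans (≮⇒≥ (λ w₀<u → u-least w₀ w₀<u w₀-meetReducible))
            (≤-trans (labelled _ _ (proj₁ (proj₂ (meetL x₀ y₀))))
              (≤-trans (labelled _ _ (proj₁ (proj₂ (joinL x₀ y₀))))
                (≮⇒≥ (λ v<j₀ → v-greatest j₀ v<j₀ j₀-joinReducible))))

    u-below : ∀ {x} → toℕ u ≤ toℕ x → T (L u x)
    u-below {x} u≤x = flip (comparable⇒≼ labelled po) u≤x $ decidable-stable (comparable? L u x) λ u∥x →
      let (w , M@(w≼u , w≼x , _)) = meetL u x in
      u-least w (index-mono-< labelled w≼u (λ w≡u → u∥x (inj₁ (subst (λ z → T (L z x)) w≡u w≼x))))
                (incomparable⇒meetReducible po u∥x M)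

    v-above : ∀ {x} → toℕ x ≤ toℕ v → T (L x v)
    v-above {x} x≤v = flip (comparable⇒≼ labelled po) x≤v $ decidable-stable (comparable? L x v) λ x∥v →
      let (j , J@(x≼j , v≼j , _)) = joinL x v in
      v-greatest j (index-mono-< labelled v≼j (λ v≡j → x∥v (inj₁ (subst (T ∘ L x) (sym v≡j) x≼j))))
                   (incomparable⇒joinReducible po x∥v J)

    a d : ℕ
    a = toℕ u
    d = toℕ v ∸ toℕ u

    a+m≡v+1 : a + suc d ≡ suc (toℕ v)
    a+m≡v+1 = trans (+-suc a d) (cong suc (m+[n∸m]≡n u≤v))

    a+m≤n : a + suc d ≤ suc n
    a+m≤n = subst (_≤ suc n) (sym a+m≡v+1) (toℕ<n v)

    B : Rel (suc d)
    B = restrict a+m≤n L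

    module P = Placement {suc n} {a} {suc d} a+m≤n
    module G = Glued {suc n} {a} {suc d} a+m≤n B

    emb-bottom : P.emb Fin.zero ≡ u
    emb-bottom = toℕ-injective (trans (P.toℕ-emb Fin.zero) (+-identityʳ a))

    emb-top : P.emb (Fin.fromℕ d) ≡ v
    emb-top = toℕ-injective (trans (P.toℕ-emb _) (trans (cong (a +_) (toℕ-fromℕ d)) (m+[n∸m]≡n u≤v)))

    outside-comparable : ∀ {x} → P.Outside x → ∀ y → Comparable L x y
    outside-comparable (inj₁ x-below) = before-u-comparable x-below
    outside-comparable {x} (inj₂ x-above) = after-v-comparable (subst (_≤ toℕ x) a+m≡v+1 x-above)

    L≅G : L ≅ G.G
    L≅G = ≗⇒≅ (≗-glue-restrict {a = a} a+m≤n po labelled outside-comparable)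

    B-po : IsPartialOrder B
    B-po = restrict-isPartialOrder a+m≤n po labelled

    B-labelled : NaturallyLabelled B
    B-labelled = restrict-labelled a+m≤n po labelled

    B-bottom : IsLeast B Fin.zero
    B-bottom q = subst (λ w → T (L w (P.emb q))) (sym emb-bottom) (u-below (P.emb-lower q))

    B-top : IsGreatest B (Fin.fromℕ d)
    B-top q = subst (T ∘ L (P.emb q)) (sym emb-top)
                (v-above (≤-pred (subst (toℕ (P.emb q) <_) a+m≡v+1 (P.emb-upper q))))

    B-rcLattice : IsLattice B × ReduciblesComparable B × HasNullity B k
    B-rcLattice = GluedBounded.block-rcLattice a+m≤n B B-po B-labelled B-bottom B-top (rcLattice-≅ L≅G L-rc)

    B-lattice = proj₁ B-rcLattice

    B-shape : IsBlockShape B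
    B-shape = (λ t t-greatest → subst (JoinReducible B) (sym (greatest≡top t-greatest)) top-joinReducible) ,
              (λ b b-least → subst (MeetReducible B) (sym (least≡bottom b-least)) bottom-meetReducible)
      where
      module L⇒G = ElementTransport L≅G
      top-joinReducible : JoinReducible B (Fin.fromℕ d)
      top-joinReducible = G.joinReducible-emb B-po B-labelled B-lattice
                            (subst (JoinReducible G.G) (sym emb-top) (L⇒G.joinReducible-to v-joinReducible))
      bottom-meetReducible : MeetReducible B Fin.zero
      bottom-meetReducible = G.meetReducible-emb B-po B-labelled B-lattice
                               (subst (MeetReducible G.G) (sym emb-bottom) (L⇒G.meetReducible-to u-meetReducible))
      greatest≡top : ∀ {t} → IsGreatest B t → t ≡ Fin.fromℕ d
      greatest≡top {t} t-greatest = toℕ-injective (≤-antisym (subst (toℕ t ≤_) (sym (toℕ-fromℕ d)) (toℕ≤pred[n] t))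
                                                           (B-labelled _ _ (t-greatest (Fin.fromℕ d))))
      least≡bottom : ∀ {b} → IsLeast B b → b ≡ Fin.zero
      least≡bottom b-least = toℕ-injective (n≤0⇒n≡0 (B-labelled _ _ (b-least Fin.zero)))

  decomposition : ∃ λ a → ∃ λ d → Σ (a + suc d ≤ suc n) λ _ → ∃ λ (B : Rel (suc d)) →
                  IsRCBlockOfNullity k B × NaturallyLabelled B × L ≅ glue (suc n) a (suc d) B
  decomposition = a , d , a+m≤n , B , (B-lattice , B-shape , proj₂ B-rcLattice) , B-labelled , L≅G


-- Counting glued blocks

GluedRCBlock : (k n a m : ℕ) → Rel n → Set
GluedRCBlock k n a m R = ∃ λ (B : Rel m) → IsRCBlockOfNullity k B × NaturallyLabelled B × R ≅ glue n a m B

gluedRCBlock-shape-unique : ∀ {k n a a′ m m′} {R S : Rel n} → a + m ≤ n → a′ + m′ ≤ n →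
                            GluedRCBlock k n a m R → GluedRCBlock k n a′ m′ S → R ≅ S → a ≡ a′ × m ≡ m′
gluedRCBlock-shape-unique {m = zero} _ _ (_ , ((_ , () , _) , _) , _) _ _
gluedRCBlock-shape-unique {m′ = zero} _ _ _ (_ , ((_ , () , _) , _) , _) _
gluedRCBlock-shape-unique {m = suc d} {m′ = suc d′} a+m≤n a′+m′≤n
  (B , (B-lattice , B-shape , _) , B-labelled , R≅G) (B′ , (B′-lattice , B′-shape , _) , B′-labelled , S≅G′) R≅S =
  let (a≡a′ , d≡d′) = glue-shape-unique a+m≤n a′+m′≤n
                        (B-lattice , B-shape , B-labelled) (B′-lattice , B′-shape , B′-labelled)
                        (≅-trans (≅-sym R≅G) (≅-trans R≅S S≅G′))
  in a≡a′ , cong suc d≡d′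

-- Labelling the representatives of the blocks and gluing them yields representatives of the glued blocks.
gluedRCBlock-count : ∀ {k n a m c} → a + m ≤ n → HasIsoClassCount m (IsRCBlockOfNullity k) c →
                     HasIsoClassCount n (GluedRCBlock k n a m) c
gluedRCBlock-count {m = zero} {c = zero} _ _ = hic-∅ (λ { _ (_ , ((_ , () , _) , _) , _) })
gluedRCBlock-count {m = zero} {c = suc _} _ (reps , reps-block , _) with reps-block Fin.zero
... | (_ , () , _) , _
gluedRCBlock-count {k} {n} {a} {suc d} {c} a+m≤n (reps , reps-block , reps-distinct , classify) =
  tabulate glued , glued-ok , glued-distinct , glued-classify
  where
  labelling : ∀ j → Σ (Rel (suc d)) λ S′ → lookup reps j ≅ S′ × NaturallyLabelled S′
  labelling j = naturalLabelling (lookup reps j) (proj₁ (proj₁ (reps-block j)))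
  rep′ : Fin c → Rel (suc d)
  rep′ j = proj₁ (labelling j)
  rep≅rep′ : ∀ j → lookup reps j ≅ rep′ j
  rep≅rep′ j = proj₁ (proj₂ (labelling j))
  rep′-block : ∀ j → IsRCBlockOfNullity k (rep′ j)
  rep′-block j = rcBlock-≅ (rep≅rep′ j) (reps-block j)
  rep′-labelledBlock : ∀ j → IsLabelledBlock (rep′ j)
  rep′-labelledBlock j = let (lattice , shape , _) = rep′-block j in lattice , shape , proj₂ (proj₂ (labelling j))
  glued : Fin c → Rel n
  glued j = glue n a (suc d) (rep′ j)

  glued-ok : ∀ j → GluedRCBlock k n a (suc d) (lookup (tabulate glued) j)
  glued-ok j rewrite lookup∘tabulate glued j = rep′ j , rep′-block j , proj₂ (proj₂ (labelling j)) , ≅-refl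

  glued-distinct : ∀ i j → Iso (lookup (tabulate glued) i) (lookup (tabulate glued) j) → i ≡ j
  glued-distinct i j Gi≅Gj rewrite lookup∘tabulate glued i | lookup∘tabulate glued j =
    reps-distinct i j (_≅_.iso (≅-trans (rep≅rep′ i)
      (≅-trans (glue-injective a+m≤n (rep′-labelledBlock i) (rep′-labelledBlock j) (mk≅ Gi≅Gj))
               (≅-sym (rep≅rep′ j)))))

  glued-classify : ∀ R → GluedRCBlock k n a (suc d) R → ∃ λ j → Iso R (lookup (tabulate glued) j)
  glued-classify R (B , B-block , _ , R≅G) =
    let (j , B≅rep) = classify B B-block
    in j , subst (Iso R) (sym (lookup∘tabulate glued j))
             (_≅_.iso (≅-trans R≅G (glue-cong a+m≤n (≅-trans (mk≅ B≅rep) (rep≅rep′ j)))))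

glued-rcLattice : ∀ {k n a m} {R : Rel n} → a + m ≤ n → GluedRCBlock k n a m R → IsRCLatticeOfNullity k R
glued-rcLattice {m = zero} _ (_ , ((_ , () , _) , _) , _)
glued-rcLattice {m = suc d} a+m≤n (B , (B-lattice , _ , B-rc , B-nullity) , B-labelled , R≅G) =
  rcLattice-≅ (≅-sym R≅G)
    (GluedBounded.glue-rcLattice a+m≤n B (proj₁ B-lattice) B-labelled
       (zero-least B-lattice B-labelled) (last-greatest B-lattice B-labelled) B-lattice B-rc B-nullity)

GluedWithChains : (k n i : ℕ) → Rel n → Set
GluedWithChains k n i R = ∃ λ a → a < suc i × GluedRCBlock k n a (n ∸ i) R

private
  a+[n∸i]≤n : ∀ {a i n} → a ≤ i → i ≤ n → a + (n ∸ i) ≤ n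
  a+[n∸i]≤n {a} {i} {n} a≤i i≤n = ≤-trans (+-monoˡ-≤ (n ∸ i) a≤i) (≤-reflexive (m+[n∸m]≡n i≤n))

gluedWithChains-rcLattice : ∀ {k n i} {R : Rel n} → i ≤ n → GluedWithChains k n i R → IsRCLatticeOfNullity k R
gluedWithChains-rcLattice i≤n (a , a<1+i , glued) = glued-rcLattice (a+[n∸i]≤n (≤-pred a<1+i) i≤n) glued

gluedWithChains-count : ∀ {k n i c} → i ≤ n → HasIsoClassCount (n ∸ i) (IsRCBlockOfNullity k) c →
                        HasIsoClassCount n (GluedWithChains k n i) (suc i * c)
gluedWithChains-count {k} {n} {i} {c} i≤n blocks =
  subst (HasIsoClassCount n _) (sum-upTo-const c (suc i))
    (hic-⋃ (λ a → GluedRCBlock k n a (n ∸ i)) (λ _ → c) (suc i)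
       (λ a<1+i a′<1+i glued glued′ R≅S →
          proj₁ (gluedRCBlock-shape-unique (a+[n∸i]≤n (≤-pred a<1+i) i≤n) (a+[n∸i]≤n (≤-pred a′<1+i) i≤n)
                                           glued glued′ R≅S))
       (λ a a<1+i → gluedRCBlock-count (a+[n∸i]≤n (≤-pred a<1+i) i≤n) blocks))

gluedWithChains-disjoint : ∀ {k n i j} {R S : Rel n} → i ≤ n → j ≤ n →
                           GluedWithChains k n i R → GluedWithChains k n j S → R ≅ S → i ≡ j
gluedWithChains-disjoint i≤n j≤n (a , a<1+i , glued) (a′ , a′<1+j , glued′) R≅S =
  ∸-cancelˡ-≡ i≤n j≤n (proj₂ (gluedRCBlock-shape-unique (a+[n∸i]≤n (≤-pred a<1+i) i≤n) (a+[n∸i]≤n (≤-pred a′<1+j) j≤n)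
                                                          glued glued′ R≅S))

rcLattice-gluedWithChains : ∀ {k n} {R : Rel n} → 1 ≤ k → IsRCLatticeOfNullity k R →
                            ∃ λ i → i ≤ n ∸ k ∸ 3 × GluedWithChains k n i R
rcLattice-gluedWithChains {n = zero} _ ((_ , () , _) , _)
rcLattice-gluedWithChains {k} {suc n} {R} k≥1 R-rc@(R-lattice , _) =
  let (S , R≅S , labelled) = naturalLabelling R (proj₁ R-lattice)
      (a , d , a+m≤n , B , B-block , B-labelled , S≅G) =
        Decomposition.decomposition labelled (rcLattice-≅ R≅S R-rc) k≥1
      m≤n = ≤-trans (m≤n+m (suc d) a) a+m≤n
      n∸i≡m = m∸[m∸n]≡n m≤n
      i≤bound = subst (suc n ∸ suc d ≤_) (sym (∸-+-assoc (suc n) k 3))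
                  (∸-monoʳ-≤ (suc n) (block-size B-labelled B-block))
      a≤i = subst (_≤ suc n ∸ suc d) (m+n∸n≡m a (suc d)) (∸-monoˡ-≤ (suc d) a+m≤n)
  in suc n ∸ suc d , i≤bound , a , s≤s a≤i ,
     subst (λ m → GluedRCBlock k (suc n) a m R) (sym n∸i≡m) (B , B-block , B-labelled , ≅-trans R≅S S≅G)

mainTheorem7 : (k n : ℕ) → 1 ≤ k → k + 3 ≤ n →
    (cL : ℕ) → HasIsoClassCount n (IsRCLatticeOfNullity k) cL →
    (cB : ℕ → ℕ) → (∀ i → i ≤ n ∸ k ∸ 3 → HasIsoClassCount (n ∸ i) (IsRCBlockOfNullity k) (cB i)) →
    cL ≡ sum (map (λ i → suc i * cB i) (upTo (suc (n ∸ k ∸ 3))))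
mainTheorem7 k n k≥1 _ _ lattices cB blocks =
  hic-unique lattices
    (hic-cong (glued⇒rcLattice , rcLattice⇒glued)
      (hic-⋃ (GluedWithChains k n) (λ i → suc i * cB i) (suc N)
        (λ i<1+N j<1+N → gluedWithChains-disjoint (i≤n i<1+N) (i≤n j<1+N))
        (λ i i<1+N → gluedWithChains-count (i≤n i<1+N) (blocks i (≤-pred i<1+N)))))
  where
  N = n ∸ k ∸ 3
  i≤n : ∀ {i} → i < suc N → i ≤ n
  i≤n i<1+N = ≤-trans (≤-pred i<1+N) (≤-trans (m∸n≤m (n ∸ k) 3) (m∸n≤m n k))
  glued⇒rcLattice : ∀ {R} → (∃ λ i → i < suc N × GluedWithChains k n i R) → IsRCLatticeOfNullity k R
  glued⇒rcLattice (i , i<1+N , glued) = gluedWithChains-rcLattice (i≤n i<1+N) glued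
  rcLattice⇒glued : ∀ {R} → IsRCLatticeOfNullity k R → ∃ λ i → i < suc N × GluedWithChains k n i R
  rcLattice⇒glued R-rc = let (i , i≤N , glued) = rcLattice-gluedWithChains k≥1 R-rc in i , s≤s i≤N , glued
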